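{- Let $p\ge3$, $n\ge 0$ be integers and $r=\min\{n,p\}$. Then \[ |E_2(H_p^n)|=\frac14\sum_{\mu=1}^{r}\sum_{\nu=0}^{\mu}\bigl(2p(\nu-\mu)+\mu(3\mu-2\nu-1)\bigr)O_p^n(\nu\mid\mu)=\frac14\sum_{\mu=1}^{r}\sum_{\nu=0}^{\mu}\bigl(2p\nu-2p\mu+3\mu^2-2\mu\nu-\mu\bigr)O_p^n(\nu\mid\mu), \] and \[ |E_1(H_p^n)|+|E_2(H_p^n)|=\frac14\sum_{\mu=1}^{r}\sum_{\nu=0}^{\mu}\bigl(3\mu^2-2p\mu-\mu+4p\nu-4\mu\nu\bigr)O_p^n(\nu\mid\mu)=\frac14\sum_{\mu=1}^{r}\sum_{\nu=0}^{\mu}\bigl(4\nu(p-\mu)+\mu(3\mu-2p-1)\bigr)O_p^n(\nu\mid\mu). \]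
   Context: For integers $p\ge 3$, $n\ge 0$, let $[p]_0=\{0,\dots,p-1\}$. The generalized Hanoi graph $H_p^n$ has vertex set $[p]_0^n$: a vertex $s=s_n\cdots s_1$ encodes a state of the Tower of Hanoi with $p$ pegs and $n$ discs of sizes $1<\dots<n$, disc $d$ lying on peg $s_d$. Two vertices are adjacent iff they have the form $\underline{s}\,i\,\overline{s}$ and $\underline{s}\,j\,\overline{s}$ with $i\ne j$, $\underline{s}\in[p]_0^{n-d}$, $\overline{s}\in([p]_0\setminus\{i,j\})^{d-1}$ for some $d$ (legal move of the top disc of peg $i$ to peg $j$). A peg is empty if it holds no disc, occupied otherwise, a singleton if it holds exactly one disc, a multiton if it holds at least two. The occupancy $o(s)$ is the number of occupied pegs. For an edge $\{u,v\}$ with $o(u)\le o(v)$, consider the move transforming $u$ into $v$ (peg types taken in $u$): $E_1(H_p^n)$ is the set of edges where this move takes a disc from a singleton peg to an empty peg; $E_2(H_p^n)$ those where it takes a disc from a multiton peg to an occupied peg. $O_p^n(\nu\mid\mu)$ is the number of states with exactly $\mu$ occupied pegs, exactly $\nu$ of which are singletons. -}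

module Defs where

open import Data.Nat using (ℕ; zero; suc; _+_; _*_; _∸_; _⊓_; _<ᵇ_; _≡ᵇ_; _≤ᵇ_)
open import Data.Bool using (Bool; true; false; _∧_; _∨_; not; if_then_else_)
open import Data.Fin using (Fin; toℕ; _≟_)
open import Data.Vec using (Vec; []; _∷_; lookup)
open import Data.List using (List; []; _∷_; [_]; map; concatMap; filterᵇ; length; allFin; upTo; cartesianProduct; foldr)
open import Data.Product using (_×_; _,_)
open import Data.Integer as ℤ using (ℤ)
open import Relation.Nullary using (does)
open import Data.Bool.ListAction using (all; any)

-- A state of the p-peg, n-disc Tower of Hanoi (a vertex of H_p^n).
-- Entry at index d : Fin n is the peg of disc of size (toℕ d + 1).
State : ℕ → ℕ → Set
State p n = Vec (Fin p) n

allStates : (p n : ℕ) → List (State p n)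
allStates p zero    = [ [] ]
allStates p (suc n) = concatMap (λ i → map (i ∷_) (allStates p n)) (allFin p)

countᵇ : {A : Set} → (A → Bool) → List A → ℕ
countᵇ f xs = length (filterᵇ f xs)

eqᵇ : {k : ℕ} → Fin k → Fin k → Bool
eqᵇ a b = does (a ≟ b)

load : {p n : ℕ} → State p n → Fin p → ℕ
load {p} {n} s k = countᵇ (λ d → eqᵇ (lookup s d) k) (allFin n)

isEmpty isOccupied isSingleton isMultiton : {p n : ℕ} → State p n → Fin p → Bool
isEmpty s k = load s k ≡ᵇ 0
isOccupied s k = not (isEmpty s k)
isSingleton s k = load s k ≡ᵇ 1
isMultiton s k = 2 ≤ᵇ load s k

occupancy : {p n : ℕ} → State p n → ℕ
occupancy {p} s = countᵇ (isOccupied s) (allFin p)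

singletons : {p n : ℕ} → State p n → ℕ
singletons {p} s = countᵇ (isSingleton s) (allFin p)

movesDisc : {p n : ℕ} → State p n → State p n → Fin n → Bool
movesDisc {p} {n} u v d =
  not (eqᵇ (lookup u d) (lookup v d))
  ∧ all (λ e → eqᵇ e d ∨ eqᵇ (lookup u e) (lookup v e)) (allFin n)
  ∧ all (λ e → not (toℕ e <ᵇ toℕ d)
               ∨ (not (eqᵇ (lookup u e) (lookup u d)) ∧ not (eqᵇ (lookup u e) (lookup v d))))
        (allFin n)

adjacent : {p n : ℕ} → State p n → State p n → Bool
adjacent {p} {n} u v = any (movesDisc u v) (allFin n)

-- injective numeric code of a state, used to list each unordered edge once
code : {p n : ℕ} → State p n → ℕ
code {p} []       = 0
code {p} (x ∷ xs) = toℕ x + p * code xs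

edges : (p n : ℕ) → List (State p n × State p n)
edges p n = filterᵇ (λ { (u , v) → (code u <ᵇ code v) ∧ adjacent u v })
                    (cartesianProduct (allStates p n) (allStates p n))

orient : {p n : ℕ} → State p n × State p n → State p n × State p n
orient (u , v) = if occupancy u ≤ᵇ occupancy v then (u , v) else (v , u)

move₁ : {p n : ℕ} → State p n → State p n → Bool
move₁ {p} {n} u v = any (λ d → movesDisc u v d
                               ∧ isSingleton u (lookup u d) ∧ isEmpty u (lookup v d)) (allFin n)

move₂ : {p n : ℕ} → State p n → State p n → Bool
move₂ {p} {n} u v = any (λ d → movesDisc u v d
                               ∧ isMultiton u (lookup u d) ∧ isOccupied u (lookup v d)) (allFin n)

inE₁ inE₂ : {p n : ℕ} → State p n × State p n → Bool
inE₁ e with orient e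
... | (u , v) = move₁ u v
inE₂ e with orient e
... | (u , v) = move₂ u v

cardE₁ cardE₂ : ℕ → ℕ → ℕ
cardE₁ p n = countᵇ inE₁ (edges p n)
cardE₂ p n = countᵇ inE₂ (edges p n)

O : (p n ν μ : ℕ) → ℕ
O p n ν μ = countᵇ (λ s → (occupancy s ≡ᵇ μ) ∧ (singletons s ≡ᵇ ν)) (allStates p n)

-- Σ_{i=a}^{b} f i  (empty if b < a), in ℤ
sumFromTo : ℕ → ℕ → (ℕ → ℤ) → ℤ
sumFromTo a b f = foldr (λ i acc → f (a + i) ℤ.+ acc) (ℤ.+ 0) (upTo (suc b ∸ a))

-- Classify the moves u → v of H_p^n by the source peg in u (singleton S or multiton M) and the
-- target peg in u (empty E or occupied O), and count ordered pairs (u, v) joined by such moves.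
-- The top disc of every occupied peg may move to every empty peg, so a state with μ occupied pegs,
-- ν of them singletons, has ν(p − μ) moves S→E and (μ − ν)(p − μ) moves M→E.  Moves onto occupied
-- pegs correspond to pairs of top discs, the smaller moving onto the larger: μ(μ − 1)/2 of them.
-- Reversing a move turns S→E into S→E, M→O into M→O and S→O into M→E.  The first two facts make the
-- orientation in the definitions of E₁ and E₂ immaterial, so ordered pairs count every edge twice:
-- 2|E₁| = Σ ν(p − μ), and by the third, 2|E₂| = Σ (μ(μ − 1)/2 − (μ − ν)(p − μ)), sums over all states.
-- Grouping the states by (μ, ν) gives the formulas.

module Submission where

open import Defs
open import Function using (_∘_)
open import Data.Bool using (Bool; true; false; _∧_; _∨_; not; T)
open import Data.Bool.Properties
  using (∧-assoc; ∧-zeroʳ; ∨-zeroʳ; ∧-identityʳ; ∧-conicalˡ; ∧-conicalʳ; ∨-distribˡ-∧; not-injective;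
         T-≡; ⇔→≡; ∧-commutativeMonoid)
open import Data.Nat
  using (ℕ; zero; suc; _≤_; _<_; _⊓_; _+_; _*_; _∸_; _≡ᵇ_; _<ᵇ_; _≤ᵇ_; z≤n; s≤s; NonZero; >-nonZero; _%_)
open import Data.Nat.Properties hiding (_≟_)
import Data.Nat.Tactic.RingSolver as ℕ-Solver
open import Data.Nat.DivMod using ([m+kn]%n≡m%n; m<n⇒m%n≡m)
open import Data.Integer as ℤ using (ℤ; +_; _-_)
import Data.Integer.Properties as ℤ
open import Data.Fin using (Fin; toℕ; zero; suc; _≟_)
import Data.Fin.Properties as Fin
open import Data.Vec using (Vec; []; _∷_; lookup)
open import Data.List
  using (List; []; _∷_; map; concatMap; filterᵇ; allFin; applyUpTo;
         cartesianProduct; foldr; tabulate; _++_)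
open import Data.Bool.ListAction using (all; any)
open import Data.Product using (_×_; _,_; ∃; proj₁; proj₂)
open import Data.Empty using (⊥-elim)
open import Data.Unit using (tt)
open import Function.Bundles using (Equivalence; mk⇔)
open import Relation.Nullary using (yes; no; ¬_; contradiction)
open import Relation.Binary.PropositionalEquality
open import Algebra.Bundles using (CommutativeMonoid)
open import Algebra.Properties.CommutativeSemigroup +-commutativeSemigroup
  using () renaming (interchange to +-interchange)
open import Algebra.Properties.CommutativeSemigroup (CommutativeMonoid.commutativeSemigroup ∧-commutativeMonoid)
  using () renaming (interchange to ∧-interchange)
open import Algebra.Properties.CommutativeSemigroup ℤ.+-commutativeSemigroup
  using () renaming (interchange to ℤ-interchange)
import Data.Integer.Tactic.RingSolver as ℤ-Solver

-- Indicators and finite sums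

⟦_⟧ : Bool → ℕ
⟦ true ⟧ = 1
⟦ false ⟧ = 0

⟦∧⟧ : ∀ a b → ⟦ a ∧ b ⟧ ≡ ⟦ a ⟧ * ⟦ b ⟧
⟦∧⟧ true b = sym (+-identityʳ ⟦ b ⟧)
⟦∧⟧ false b = refl

⟦∧∧⟧ : ∀ a b c → ⟦ a ∧ b ∧ c ⟧ ≡ ⟦ a ⟧ * (⟦ b ⟧ * ⟦ c ⟧)
⟦∧∧⟧ a b c = trans (⟦∧⟧ a (b ∧ c)) (cong (⟦ a ⟧ *_) (⟦∧⟧ b c))

⟦⟧-idem : ∀ b → ⟦ b ⟧ * ⟦ b ⟧ ≡ ⟦ b ⟧
⟦⟧-idem true = refl
⟦⟧-idem false = refl

⟦⟧≡0 : {b : Bool} → ⟦ b ⟧ ≡ 0 → b ≡ false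
⟦⟧≡0 {false} _ = refl

ΣF : (n : ℕ) → (Fin n → ℕ) → ℕ
ΣF zero f = 0
ΣF (suc n) f = f zero + ΣF n (f ∘ suc)

ΣF-cong : (n : ℕ) {f g : Fin n → ℕ} → (∀ i → f i ≡ g i) → ΣF n f ≡ ΣF n g
ΣF-cong zero eq = refl
ΣF-cong (suc n) eq = cong₂ _+_ (eq zero) (ΣF-cong n (eq ∘ suc))

ΣF-0 : (n : ℕ) {f : Fin n → ℕ} → (∀ i → f i ≡ 0) → ΣF n f ≡ 0
ΣF-0 zero eq = refl
ΣF-0 (suc n) eq = cong₂ _+_ (eq zero) (ΣF-0 n (eq ∘ suc))

ΣF-+ : (n : ℕ) (f g : Fin n → ℕ) → ΣF n (λ i → f i + g i) ≡ ΣF n f + ΣF n g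
ΣF-+ zero f g = refl
ΣF-+ (suc n) f g =
  trans (cong (_+_ (f zero + g zero)) (ΣF-+ n (f ∘ suc) (g ∘ suc))) (+-interchange (f zero) (g zero) _ _)

ΣF-+₃ : (n : ℕ) (f g h : Fin n → ℕ) → ΣF n (λ i → f i + g i + h i) ≡ ΣF n f + ΣF n g + ΣF n h
ΣF-+₃ n f g h = trans (ΣF-+ n _ h) (cong (_+ ΣF n h) (ΣF-+ n f g))

ΣF-*ˡ : (n c : ℕ) (f : Fin n → ℕ) → ΣF n (λ i → c * f i) ≡ c * ΣF n f
ΣF-*ˡ zero c f = sym (*-zeroʳ c)
ΣF-*ˡ (suc n) c f = trans (cong (_+_ (c * f zero)) (ΣF-*ˡ n c (f ∘ suc))) (sym (*-distribˡ-+ c (f zero) _))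

ΣF-*ʳ : (n c : ℕ) (f : Fin n → ℕ) → ΣF n (λ i → f i * c) ≡ ΣF n f * c
ΣF-*ʳ n c f = trans (ΣF-cong n (λ i → *-comm (f i) c)) (trans (ΣF-*ˡ n c f) (*-comm c _))

ΣF-swap : (m n : ℕ) (f : Fin m → Fin n → ℕ) →
  ΣF m (λ i → ΣF n (f i)) ≡ ΣF n (λ j → ΣF m (λ i → f i j))
ΣF-swap zero n f = sym (ΣF-0 n (λ _ → refl))
ΣF-swap (suc m) n f = trans (cong (_+_ (ΣF n (f zero))) (ΣF-swap m n (f ∘ suc))) (sym (ΣF-+ n _ _))

ΣF-1 : (n : ℕ) → ΣF n (λ _ → 1) ≡ n
ΣF-1 zero = refl
ΣF-1 (suc n) = cong suc (ΣF-1 n)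

≤-ΣF : (n : ℕ) (f : Fin n → ℕ) (i : Fin n) → f i ≤ ΣF n f
≤-ΣF (suc n) f zero = m≤m+n _ _
≤-ΣF (suc n) f (suc i) = ≤-trans (≤-ΣF n (f ∘ suc) i) (m≤n+m _ (f zero))

ΣF-⟦⟧≤ : (n : ℕ) (f : Fin n → Bool) → ΣF n (⟦_⟧ ∘ f) ≤ n
ΣF-⟦⟧≤ zero f = z≤n
ΣF-⟦⟧≤ (suc n) f with f zero
... | true = s≤s (ΣF-⟦⟧≤ n (f ∘ suc))
... | false = m≤n⇒m≤1+n (ΣF-⟦⟧≤ n (f ∘ suc))

ΣL : {A : Set} → List A → (A → ℕ) → ℕ
ΣL [] f = 0
ΣL (x ∷ xs) f = f x + ΣL xs f

ΣL-cong : {A : Set} (xs : List A) {f g : A → ℕ} → (∀ x → f x ≡ g x) → ΣL xs f ≡ ΣL xs g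
ΣL-cong [] eq = refl
ΣL-cong (x ∷ xs) eq = cong₂ _+_ (eq x) (ΣL-cong xs eq)

ΣL-0 : {A : Set} (xs : List A) {f : A → ℕ} → (∀ x → f x ≡ 0) → ΣL xs f ≡ 0
ΣL-0 [] eq = refl
ΣL-0 (x ∷ xs) eq = cong₂ _+_ (eq x) (ΣL-0 xs eq)

ΣL-+ : {A : Set} (xs : List A) (f g : A → ℕ) → ΣL xs (λ x → f x + g x) ≡ ΣL xs f + ΣL xs g
ΣL-+ [] f g = refl
ΣL-+ (x ∷ xs) f g = trans (cong (_+_ (f x + g x)) (ΣL-+ xs f g)) (+-interchange (f x) (g x) _ _)

ΣL-*ˡ : {A : Set} (xs : List A) (c : ℕ) (f : A → ℕ) → ΣL xs (λ x → c * f x) ≡ c * ΣL xs f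
ΣL-*ˡ [] c f = sym (*-zeroʳ c)
ΣL-*ˡ (x ∷ xs) c f = trans (cong (_+_ (c * f x)) (ΣL-*ˡ xs c f)) (sym (*-distribˡ-+ c (f x) _))

ΣL-swap : {A B : Set} (xs : List A) (ys : List B) (f : A → B → ℕ) →
  ΣL xs (λ x → ΣL ys (f x)) ≡ ΣL ys (λ y → ΣL xs (λ x → f x y))
ΣL-swap [] ys f = sym (ΣL-0 ys (λ _ → refl))
ΣL-swap (x ∷ xs) ys f = trans (cong (_+_ (ΣL ys (f x))) (ΣL-swap xs ys f)) (sym (ΣL-+ ys _ _))

ΣL-ΣF-swap : {A : Set} (xs : List A) (n : ℕ) (f : A → Fin n → ℕ) →
  ΣL xs (λ x → ΣF n (f x)) ≡ ΣF n (λ j → ΣL xs (λ x → f x j))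
ΣL-ΣF-swap [] n f = sym (ΣF-0 n (λ _ → refl))
ΣL-ΣF-swap (x ∷ xs) n f = trans (cong (_+_ (ΣF n (f x))) (ΣL-ΣF-swap xs n f)) (sym (ΣF-+ n _ _))

ΣL-++ : {A : Set} (xs ys : List A) (f : A → ℕ) → ΣL (xs ++ ys) f ≡ ΣL xs f + ΣL ys f
ΣL-++ [] ys f = refl
ΣL-++ (x ∷ xs) ys f = trans (cong (_+_ (f x)) (ΣL-++ xs ys f)) (sym (+-assoc (f x) _ _))

ΣL-map : {A B : Set} (g : A → B) (xs : List A) (f : B → ℕ) → ΣL (map g xs) f ≡ ΣL xs (f ∘ g)
ΣL-map g [] f = refl
ΣL-map g (x ∷ xs) f = cong (_+_ (f (g x))) (ΣL-map g xs f)

ΣL-concatMap : {A B : Set} (g : A → List B) (xs : List A) (f : B → ℕ) →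
  ΣL (concatMap g xs) f ≡ ΣL xs (λ x → ΣL (g x) f)
ΣL-concatMap g [] f = refl
ΣL-concatMap g (x ∷ xs) f =
  trans (ΣL-++ (g x) (concatMap g xs) f) (cong (_+_ (ΣL (g x) f)) (ΣL-concatMap g xs f))

ΣL-cartesianProduct : {A B : Set} (xs : List A) (ys : List B) (f : A × B → ℕ) →
  ΣL (cartesianProduct xs ys) f ≡ ΣL xs (λ x → ΣL ys (λ y → f (x , y)))
ΣL-cartesianProduct [] ys f = refl
ΣL-cartesianProduct (x ∷ xs) ys f =
  trans (ΣL-++ (map (x ,_) ys) _ f) (cong₂ _+_ (ΣL-map (x ,_) ys f) (ΣL-cartesianProduct xs ys f))

ΣL-tabulate : {A : Set} (n : ℕ) (g : Fin n → A) (f : A → ℕ) → ΣL (tabulate g) f ≡ ΣF n (f ∘ g)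
ΣL-tabulate zero g f = refl
ΣL-tabulate (suc n) g f = cong (_+_ (f (g zero))) (ΣL-tabulate n (g ∘ suc) f)

ΣL-allFin : (n : ℕ) (f : Fin n → ℕ) → ΣL (allFin n) f ≡ ΣF n f
ΣL-allFin n = ΣL-tabulate n (λ i → i)

countᵇ≡ΣL : {A : Set} (f : A → Bool) (xs : List A) → countᵇ f xs ≡ ΣL xs (⟦_⟧ ∘ f)
countᵇ≡ΣL f [] = refl
countᵇ≡ΣL f (x ∷ xs) with f x
... | true = cong suc (countᵇ≡ΣL f xs)
... | false = countᵇ≡ΣL f xs

countᵇ-filterᵇ : {A : Set} (g f : A → Bool) (xs : List A) →
  countᵇ f (filterᵇ g xs) ≡ ΣL xs (λ x → ⟦ g x ∧ f x ⟧)
countᵇ-filterᵇ g f [] = refl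
countᵇ-filterᵇ g f (x ∷ xs) with g x
... | false = countᵇ-filterᵇ g f xs
... | true with f x
... | true = cong suc (countᵇ-filterᵇ g f xs)
... | false = countᵇ-filterᵇ g f xs

eqᵇ-refl : {k : ℕ} (a : Fin k) → eqᵇ a a ≡ true
eqᵇ-refl a with a ≟ a
... | yes _ = refl
... | no a≢a = ⊥-elim (a≢a refl)

eqᵇ⇒≡ : {k : ℕ} {a b : Fin k} → eqᵇ a b ≡ true → a ≡ b
eqᵇ⇒≡ {a = a} {b} e with a ≟ b
... | yes a≡b = a≡b

≢⇒eqᵇ-false : {k : ℕ} {a b : Fin k} → ¬ a ≡ b → eqᵇ a b ≡ false
≢⇒eqᵇ-false {a = a} {b} a≢b with a ≟ b
... | yes a≡b = ⊥-elim (a≢b a≡b)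
... | no _ = refl

eqᵇ-false⇒≢ : {k : ℕ} {a b : Fin k} → eqᵇ a b ≡ false → ¬ a ≡ b
eqᵇ-false⇒≢ {a = a} e refl with () ← trans (sym (eqᵇ-refl a)) e

eqᵇ-sym : {k : ℕ} (a b : Fin k) → eqᵇ a b ≡ eqᵇ b a
eqᵇ-sym a b with a ≟ b
... | yes refl = sym (eqᵇ-refl a)
... | no a≢b = sym (≢⇒eqᵇ-false (a≢b ∘ sym))

∨-resolveˡ : {a b : Bool} → a ∨ b ≡ true → a ≡ false → b ≡ true
∨-resolveˡ e refl = e

∧-congˡ-when : {a b : Bool} (s c : Bool) → (c ≡ true → a ≡ b) → a ∧ s ∧ c ≡ b ∧ s ∧ c
∧-congˡ-when s true a≡b = cong (_∧ s ∧ true) (a≡b refl)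
∧-congˡ-when {a} {b} s false _ =
  trans (cong (a ∧_) (∧-zeroʳ s)) (trans (∧-zeroʳ a) (sym (trans (cong (b ∧_) (∧-zeroʳ s)) (∧-zeroʳ b))))

eqᵇ-≡ : {k : ℕ} {a b : Fin k} → a ≡ b → eqᵇ a b ≡ true
eqᵇ-≡ {a = a} refl = eqᵇ-refl a

<ᵇ-true⇒< : ∀ m n → (m <ᵇ n) ≡ true → m < n
<ᵇ-true⇒< m n e = <ᵇ⇒< m n (subst T (sym e) tt)

<⇒<ᵇ-true : {m n : ℕ} → m < n → (m <ᵇ n) ≡ true
<⇒<ᵇ-true lt = Equivalence.to T-≡ (<⇒<ᵇ lt)

<ᵇ-false⇒≥ : {m n : ℕ} → (m <ᵇ n) ≡ false → n ≤ m
<ᵇ-false⇒≥ e = ≮⇒≥ (λ lt → contradiction (trans (sym (<⇒<ᵇ-true lt)) e) λ ())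

ΣF-delta : (p : ℕ) (a : Fin p) (G : Fin p → ℕ) → ΣF p (λ i → ⟦ eqᵇ a i ⟧ * G i) ≡ G a
ΣF-delta (suc p) zero G =
  trans (cong (_+_ (G zero + 0)) (ΣF-0 p (λ _ → refl))) (trans (+-identityʳ _) (+-identityʳ _))
ΣF-delta (suc p) (suc a) G = ΣF-delta p a (G ∘ suc)

ΣF-deltaʳ : (p : ℕ) (a : Fin p) (G : Fin p → ℕ) → ΣF p (λ i → ⟦ eqᵇ i a ⟧ * G i) ≡ G a
ΣF-deltaʳ p a G = trans (ΣF-cong p (λ i → cong (λ b → ⟦ b ⟧ * G i) (eqᵇ-sym i a))) (ΣF-delta p a G)

allF anyF : (n : ℕ) → (Fin n → Bool) → Bool
allF zero f = true
allF (suc n) f = f zero ∧ allF n (f ∘ suc)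
anyF zero f = false
anyF (suc n) f = f zero ∨ anyF n (f ∘ suc)

all-tabulate : {A : Set} (n : ℕ) (g : Fin n → A) (f : A → Bool) → all f (tabulate g) ≡ allF n (f ∘ g)
all-tabulate zero g f = refl
all-tabulate (suc n) g f = cong (f (g zero) ∧_) (all-tabulate n (g ∘ suc) f)

any-tabulate : {A : Set} (n : ℕ) (g : Fin n → A) (f : A → Bool) → any f (tabulate g) ≡ anyF n (f ∘ g)
any-tabulate zero g f = refl
any-tabulate (suc n) g f = cong (f (g zero) ∨_) (any-tabulate n (g ∘ suc) f)

all-allFin : (n : ℕ) (f : Fin n → Bool) → all f (allFin n) ≡ allF n f
all-allFin n = all-tabulate n (λ i → i)

any-allFin : (n : ℕ) (f : Fin n → Bool) → any f (allFin n) ≡ anyF n f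
any-allFin n = any-tabulate n (λ i → i)

allF-elim : (n : ℕ) {f : Fin n → Bool} → allF n f ≡ true → ∀ i → f i ≡ true
allF-elim (suc n) {f} e zero = ∧-conicalˡ (f zero) _ e
allF-elim (suc n) {f} e (suc i) = allF-elim n (∧-conicalʳ (f zero) _ e) i

allF-intro : (n : ℕ) {f : Fin n → Bool} → (∀ i → f i ≡ true) → allF n f ≡ true
allF-intro zero h = refl
allF-intro (suc n) h = cong₂ _∧_ (h zero) (allF-intro n (h ∘ suc))

allF-false : (n : ℕ) (f : Fin n → Bool) (i : Fin n) → f i ≡ false → allF n f ≡ false
allF-false (suc n) f zero e = cong (_∧ allF n (f ∘ suc)) e
allF-false (suc n) f (suc i) e = trans (cong (f zero ∧_) (allF-false n (f ∘ suc) i e)) (∧-zeroʳ (f zero))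

allF-cong : (n : ℕ) {f g : Fin n → Bool} → (∀ i → f i ≡ g i) → allF n f ≡ allF n g
allF-cong zero eq = refl
allF-cong (suc n) eq = cong₂ _∧_ (eq zero) (allF-cong n (eq ∘ suc))

allF-∧ : (n : ℕ) (f g : Fin n → Bool) → allF n (λ i → f i ∧ g i) ≡ allF n f ∧ allF n g
allF-∧ zero f g = refl
allF-∧ (suc n) f g =
  trans (cong ((f zero ∧ g zero) ∧_) (allF-∧ n (f ∘ suc) (g ∘ suc))) (∧-interchange (f zero) (g zero) _ _)

anyF-elim : (n : ℕ) {f : Fin n → Bool} → anyF n f ≡ true → ∃ λ i → f i ≡ true
anyF-elim (suc n) {f} e with f zero in f0
... | true = zero , f0
... | false with anyF-elim n e
... | i , fi = suc i , fi

anyF-intro : (n : ℕ) {f : Fin n → Bool} (i : Fin n) → f i ≡ true → anyF n f ≡ true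
anyF-intro (suc n) {f} zero e = cong (_∨ anyF n (f ∘ suc)) e
anyF-intro (suc n) {f} (suc i) e with f zero
... | true = refl
... | false = anyF-intro n i e

⟦anyF⟧≡ΣF : (n : ℕ) (P : Fin n → Bool) → (∀ d d' → P d ≡ true → P d' ≡ true → d ≡ d') →
  ⟦ anyF n P ⟧ ≡ ΣF n (⟦_⟧ ∘ P)
⟦anyF⟧≡ΣF zero P unique = refl
⟦anyF⟧≡ΣF (suc n) P unique with P zero in P0
... | true = sym (cong suc (ΣF-0 n (λ i → cong ⟦_⟧ (only-zero i))))
  where
  only-zero : (i : Fin n) → P (suc i) ≡ false
  only-zero i with P (suc i) in Pi
  ... | true with () ← unique zero (suc i) P0 Pi
  ... | false = refl
... | false = ⟦anyF⟧≡ΣF n (P ∘ suc) (λ d d' e e' → Fin.suc-injective (unique (suc d) (suc d') e e'))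

<ᵇ-trichotomy : {n : ℕ} (d d' : Fin n) → ⟦ toℕ d <ᵇ toℕ d' ⟧ + ⟦ toℕ d' <ᵇ toℕ d ⟧ + ⟦ eqᵇ d d' ⟧ ≡ 1
<ᵇ-trichotomy zero zero = refl
<ᵇ-trichotomy zero (suc d') = refl
<ᵇ-trichotomy (suc d) zero = refl
<ᵇ-trichotomy (suc d) (suc d') = <ᵇ-trichotomy d d'

<ᵇ-dichotomy : ∀ a b → a ≢ b → ⟦ a <ᵇ b ⟧ + ⟦ b <ᵇ a ⟧ ≡ 1
<ᵇ-dichotomy zero zero a≢b = ⊥-elim (a≢b refl)
<ᵇ-dichotomy zero (suc b) _ = refl
<ᵇ-dichotomy (suc a) zero _ = refl
<ᵇ-dichotomy (suc a) (suc b) a≢b = <ᵇ-dichotomy a b (a≢b ∘ cong suc)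

ΣF-square : (n : ℕ) (f : Fin n → ℕ) →
  ΣF n f * ΣF n f
    ≡ 2 * ΣF n (λ d → ΣF n (λ d' → ⟦ toℕ d <ᵇ toℕ d' ⟧ * (f d * f d'))) + ΣF n (λ d → f d * f d)
ΣF-square n f = begin
  ΣF n f * ΣF n f
    ≡⟨ sym (trans (ΣF-cong n (λ d → ΣF-*ˡ n (f d) f)) (ΣF-*ʳ n (ΣF n f) f)) ⟩
  ΣF n (λ d → ΣF n (λ d' → f d * f d'))
    ≡⟨ ΣF-cong n (λ d → ΣF-cong n (λ d' → split d d')) ⟩
  ΣF n (λ d → ΣF n (λ d' → below d d' + below d' d + diagonal d d'))
    ≡⟨ trans (ΣF-cong n (λ d → ΣF-+₃ n _ _ _)) (ΣF-+₃ n _ _ _) ⟩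
  L + ΣF n (λ d → ΣF n (λ d' → below d' d)) + ΣF n (λ d → ΣF n (diagonal d))
    ≡⟨ cong₂ (λ x y → L + x + y) (ΣF-swap n n (λ d d' → below d' d))
                                 (ΣF-cong n (λ d → ΣF-delta n d (λ d' → f d * f d'))) ⟩
  L + L + ΣF n (λ d → f d * f d)
    ≡⟨ cong (λ x → L + x + ΣF n (λ d → f d * f d)) (sym (+-identityʳ L)) ⟩
  2 * L + ΣF n (λ d → f d * f d) ∎
  where
  open ≡-Reasoning
  below diagonal : Fin n → Fin n → ℕ
  below d d' = ⟦ toℕ d <ᵇ toℕ d' ⟧ * (f d * f d')
  diagonal d d' = ⟦ eqᵇ d d' ⟧ * (f d * f d')
  L = ΣF n (λ d → ΣF n (below d))
  split : (d d' : Fin n) → f d * f d' ≡ below d d' + below d' d + diagonal d d'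
  split d d' = begin
    f d * f d'
      ≡⟨ sym (*-identityˡ _) ⟩
    1 * (f d * f d')
      ≡⟨ cong (_* (f d * f d')) (sym (<ᵇ-trichotomy d d')) ⟩
    (⟦ toℕ d <ᵇ toℕ d' ⟧ + ⟦ toℕ d' <ᵇ toℕ d ⟧ + ⟦ eqᵇ d d' ⟧) * (f d * f d')
      ≡⟨ trans (*-distribʳ-+ _ (⟦ toℕ d <ᵇ toℕ d' ⟧ + ⟦ toℕ d' <ᵇ toℕ d ⟧) _)
               (cong (_+ diagonal d d') (*-distribʳ-+ (f d * f d') ⟦ toℕ d <ᵇ toℕ d' ⟧ _)) ⟩
    below d d' + ⟦ toℕ d' <ᵇ toℕ d ⟧ * (f d * f d') + diagonal d d'
      ≡⟨ cong (λ x → below d d' + ⟦ toℕ d' <ᵇ toℕ d ⟧ * x + diagonal d d') (*-comm (f d) (f d')) ⟩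
    below d d' + below d' d + diagonal d d' ∎

-- States and moves

ΣS : (p n : ℕ) → (State p n → ℕ) → ℕ
ΣS p n = ΣL (allStates p n)

ΣS-cong : (p n : ℕ) {f g : State p n → ℕ} → (∀ u → f u ≡ g u) → ΣS p n f ≡ ΣS p n g
ΣS-cong p n = ΣL-cong (allStates p n)

ΣS-*ˡ : (p n c : ℕ) (f : State p n → ℕ) → ΣS p n (λ u → c * f u) ≡ c * ΣS p n f
ΣS-*ˡ p n = ΣL-*ˡ (allStates p n)

ΣS-∷ : (p n : ℕ) (F : State p (suc n) → ℕ) → ΣS p (suc n) F ≡ ΣF p (λ i → ΣS p n (F ∘ (i ∷_)))
ΣS-∷ p n F =
  trans (ΣL-concatMap (λ i → map (i ∷_) (allStates p n)) (allFin p) F)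
        (trans (ΣL-allFin p _) (ΣF-cong p (λ i → ΣL-map (i ∷_) (allStates p n) F)))

ΣS² : (p n : ℕ) → (State p n → State p n → Bool) → ℕ
ΣS² p n mv = ΣS p n (λ u → ΣS p n (⟦_⟧ ∘ mv u))

module _ {p n : ℕ} where

  discsOn : State p n → Fin p → ℕ
  discsOn u k = ΣF n (λ d → ⟦ eqᵇ (lookup u d) k ⟧)

  load≡discsOn : (u : State p n) (k : Fin p) → load u k ≡ discsOn u k
  load≡discsOn u k = trans (countᵇ≡ΣL _ (allFin n)) (ΣL-allFin n _)

  agreeOff : State p n → State p n → Fin n → Bool
  agreeOff u v d = allF n (λ e → eqᵇ e d ∨ eqᵇ (lookup u e) (lookup v e))

  unobstructed : State p n → Fin n → Fin p → Bool
  unobstructed u d j = allF n (λ e → not (toℕ e <ᵇ toℕ d)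
                                       ∨ (not (eqᵇ (lookup u e) (lookup u d)) ∧ not (eqᵇ (lookup u e) j)))

  canMove : State p n → Fin n → Fin p → Bool
  canMove u d j = not (eqᵇ (lookup u d) j) ∧ unobstructed u d j

  movesDisc≡ : (u v : State p n) (d : Fin n) →
    movesDisc u v d ≡ agreeOff u v d ∧ canMove u d (lookup v d)
  movesDisc≡ u v d = begin
    movesDisc u v d
      ≡⟨ cong₂ (λ a b → not (eqᵇ (lookup u d) (lookup v d)) ∧ a ∧ b) (all-allFin n _) (all-allFin n _) ⟩
    not (eqᵇ (lookup u d) (lookup v d)) ∧ agreeOff u v d ∧ unobstructed u d (lookup v d)
      ≡⟨ ∧-left-swap (not (eqᵇ (lookup u d) (lookup v d))) (agreeOff u v d) _ ⟩
    agreeOff u v d ∧ canMove u d (lookup v d) ∎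
    where
    open ≡-Reasoning
    ∧-left-swap : ∀ a b c → a ∧ b ∧ c ≡ b ∧ a ∧ c
    ∧-left-swap true b c = refl
    ∧-left-swap false b c = sym (∧-zeroʳ b)

  sameState : State p n → State p n → Bool
  sameState u v = allF n (λ e → eqᵇ (lookup u e) (lookup v e))

ΣS-sameState : {p n : ℕ} (u : State p n) → ΣS p n (⟦_⟧ ∘ sameState u) ≡ 1
ΣS-sameState {p} {zero} [] = refl
ΣS-sameState {p} {suc n} (a ∷ u) = begin
  ΣS p (suc n) (⟦_⟧ ∘ sameState (a ∷ u))
    ≡⟨ ΣS-∷ p n _ ⟩
  ΣF p (λ i → ΣS p n (λ w → ⟦ eqᵇ a i ∧ sameState u w ⟧))
    ≡⟨ ΣF-cong p (λ i → trans (ΣS-cong p n (λ w → ⟦∧⟧ (eqᵇ a i) _)) (ΣS-*ˡ p n ⟦ eqᵇ a i ⟧ _)) ⟩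
  ΣF p (λ i → ⟦ eqᵇ a i ⟧ * ΣS p n (⟦_⟧ ∘ sameState u))
    ≡⟨ ΣF-delta p a (λ _ → ΣS p n (⟦_⟧ ∘ sameState u)) ⟩
  ΣS p n (⟦_⟧ ∘ sameState u)
    ≡⟨ ΣS-sameState u ⟩
  1 ∎
  where open ≡-Reasoning

-- The states agreeing with u off disc d are parametrised by the peg of d.
ΣS-agreeOff : {p n : ℕ} (u : State p n) (d : Fin n) (h : Fin p → Bool) →
  ΣS p n (λ v → ⟦ agreeOff u v d ∧ h (lookup v d) ⟧) ≡ ΣF p (⟦_⟧ ∘ h)
ΣS-agreeOff {p} {suc n} (a ∷ u) zero h =
  trans (ΣS-∷ p n _) (ΣF-cong p (λ i → begin
    ΣS p n (λ w → ⟦ sameState u w ∧ h i ⟧)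
      ≡⟨ ΣS-cong p n (λ w → trans (⟦∧⟧ (sameState u w) (h i)) (*-comm _ ⟦ h i ⟧)) ⟩
    ΣS p n (λ w → ⟦ h i ⟧ * ⟦ sameState u w ⟧)
      ≡⟨ ΣS-*ˡ p n ⟦ h i ⟧ _ ⟩
    ⟦ h i ⟧ * ΣS p n (⟦_⟧ ∘ sameState u)
      ≡⟨ cong (⟦ h i ⟧ *_) (ΣS-sameState u) ⟩
    ⟦ h i ⟧ * 1
      ≡⟨ *-identityʳ _ ⟩
    ⟦ h i ⟧ ∎))
  where open ≡-Reasoning
ΣS-agreeOff {p} {suc n} (a ∷ u) (suc d) h = begin
  ΣS p (suc n) (λ v → ⟦ agreeOff (a ∷ u) v (suc d) ∧ h (lookup v (suc d)) ⟧)
    ≡⟨ ΣS-∷ p n _ ⟩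
  ΣF p (λ i → ΣS p n (λ w → ⟦ (eqᵇ a i ∧ agreeOff u w d) ∧ h (lookup w d) ⟧))
    ≡⟨ ΣF-cong p (λ i → trans (ΣS-cong p n (λ w → trans (cong ⟦_⟧ (∧-assoc (eqᵇ a i) _ _))
                                                        (⟦∧⟧ (eqᵇ a i) _)))
                              (ΣS-*ˡ p n ⟦ eqᵇ a i ⟧ _)) ⟩
  ΣF p (λ i → ⟦ eqᵇ a i ⟧ * ΣS p n (λ w → ⟦ agreeOff u w d ∧ h (lookup w d) ⟧))
    ≡⟨ ΣF-delta p a _ ⟩
  ΣS p n (λ w → ⟦ agreeOff u w d ∧ h (lookup w d) ⟧)
    ≡⟨ ΣS-agreeOff u d h ⟩
  ΣF p (⟦_⟧ ∘ h) ∎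
  where open ≡-Reasoning

module _ {p n : ℕ} where

  record Move (u v : State p n) (d : Fin n) : Set where
    field
      moved  : lookup u d ≢ lookup v d
      others : ∀ e → e ≢ d → lookup u e ≡ lookup v e
      clear  : ∀ e → toℕ e < toℕ d → lookup u e ≢ lookup u d × lookup u e ≢ lookup v d

  movesDisc⇒Move : {u v : State p n} {d : Fin n} → movesDisc u v d ≡ true → Move u v d
  movesDisc⇒Move {u} {v} {d} md = record
    { moved  = eqᵇ-false⇒≢ (not-injective (∧-conicalˡ (not (eqᵇ (lookup u d) (lookup v d))) _ can))
    ; others = λ e e≢d → eqᵇ⇒≡ (∨-resolveˡ (allF-elim n agree e) (≢⇒eqᵇ-false e≢d))
    ; clear  = λ e lt → let c = ∨-resolveˡ (allF-elim n unobstr e) (cong not (<⇒<ᵇ-true lt)) in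
                 eqᵇ-false⇒≢ (not-injective (∧-conicalˡ _ _ c)) ,
                 eqᵇ-false⇒≢ (not-injective (∧-conicalʳ _ _ c))
    }
    where
    md′ : agreeOff u v d ∧ canMove u d (lookup v d) ≡ true
    md′ = trans (sym (movesDisc≡ u v d)) md
    agree : agreeOff u v d ≡ true
    agree = ∧-conicalˡ (agreeOff u v d) _ md′
    can : canMove u d (lookup v d) ≡ true
    can = ∧-conicalʳ (agreeOff u v d) _ md′
    unobstr : unobstructed u d (lookup v d) ≡ true
    unobstr = ∧-conicalʳ (not (eqᵇ (lookup u d) (lookup v d))) _ can

  Move⇒movesDisc : {u v : State p n} {d : Fin n} → Move u v d → movesDisc u v d ≡ true
  Move⇒movesDisc {u} {v} {d} m =
    cong₂ _∧_ (cong not (≢⇒eqᵇ-false moved))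
              (cong₂ _∧_ (trans (all-allFin n _) (allF-intro n agree))
                         (trans (all-allFin n _) (allF-intro n unobstr)))
    where
    open Move m
    agree : ∀ e → (eqᵇ e d ∨ eqᵇ (lookup u e) (lookup v e)) ≡ true
    agree e with eqᵇ e d in e≟d
    ... | true = refl
    ... | false = eqᵇ-≡ (others e (eqᵇ-false⇒≢ e≟d))
    unobstr : ∀ e → (not (toℕ e <ᵇ toℕ d)
                     ∨ (not (eqᵇ (lookup u e) (lookup u d)) ∧ not (eqᵇ (lookup u e) (lookup v d)))) ≡ true
    unobstr e with toℕ e <ᵇ toℕ d in lt
    ... | false = refl
    ... | true = let (off-source , off-target) = clear e (<ᵇ-true⇒< (toℕ e) (toℕ d) lt) in
                 cong₂ _∧_ (cong not (≢⇒eqᵇ-false off-source)) (cong not (≢⇒eqᵇ-false off-target))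

  Move-sym : {u v : State p n} {d : Fin n} → Move u v d → Move v u d
  Move-sym {u} {v} {d} m = record
    { moved  = moved ∘ sym
    ; others = λ e e≢d → sym (others e e≢d)
    ; clear  = λ e lt → let (off-source , off-target) = clear e lt
                            u≡v = others e (λ { refl → <-irrefl refl lt }) in
                 off-target ∘ trans u≡v , off-source ∘ trans u≡v
    }
    where open Move m

  Move-unique : {u v : State p n} {d d' : Fin n} → Move u v d → Move u v d' → d ≡ d'
  Move-unique {d = d} {d'} m m' with d' ≟ d
  ... | yes d'≡d = sym d'≡d
  ... | no d'≢d = ⊥-elim (Move.moved m' (Move.others m d' d'≢d))

  Move⇒≢ : {u v : State p n} {d : Fin n} → Move u v d → u ≢ v
  Move⇒≢ {d = d} m u≡v = Move.moved m (cong (λ w → lookup w d) u≡v)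

  discsOn-Move : {u v : State p n} {d : Fin n} → Move u v d → (k : Fin p) →
    discsOn v k + ⟦ eqᵇ (lookup u d) k ⟧ ≡ discsOn u k + ⟦ eqᵇ (lookup v d) k ⟧
  discsOn-Move {u} {v} {d} m k = begin
    discsOn v k + c₁
      ≡⟨ cong (_+_ (discsOn v k)) (sym (ΣF-deltaʳ n d (λ _ → c₁))) ⟩
    discsOn v k + ΣF n (λ e → ⟦ eqᵇ e d ⟧ * c₁)
      ≡⟨ sym (ΣF-+ n _ _) ⟩
    ΣF n (λ e → ⟦ eqᵇ (lookup v e) k ⟧ + ⟦ eqᵇ e d ⟧ * c₁)
      ≡⟨ ΣF-cong n exchange ⟩
    ΣF n (λ e → ⟦ eqᵇ (lookup u e) k ⟧ + ⟦ eqᵇ e d ⟧ * c₂)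
      ≡⟨ ΣF-+ n _ _ ⟩
    discsOn u k + ΣF n (λ e → ⟦ eqᵇ e d ⟧ * c₂)
      ≡⟨ cong (_+_ (discsOn u k)) (ΣF-deltaʳ n d (λ _ → c₂)) ⟩
    discsOn u k + c₂ ∎
    where
    open ≡-Reasoning
    c₁ = ⟦ eqᵇ (lookup u d) k ⟧
    c₂ = ⟦ eqᵇ (lookup v d) k ⟧
    exchange : (e : Fin n) →
      ⟦ eqᵇ (lookup v e) k ⟧ + ⟦ eqᵇ e d ⟧ * c₁ ≡ ⟦ eqᵇ (lookup u e) k ⟧ + ⟦ eqᵇ e d ⟧ * c₂
    exchange e with eqᵇ e d in e≟d
    ... | false = cong (λ x → ⟦ eqᵇ x k ⟧ + 0) (sym (Move.others m e (eqᵇ-false⇒≢ e≟d)))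
    ... | true with refl ← eqᵇ⇒≡ {a = e} {b = d} e≟d =
      trans (+-comm c₂ (c₁ + 0)) (cong₂ _+_ (+-identityʳ c₁) (sym (+-identityʳ c₂)))

  discsOn-source : {u v : State p n} {d : Fin n} → Move u v d →
    discsOn u (lookup u d) ≡ suc (discsOn v (lookup u d))
  discsOn-source {u} {v} {d} m = begin
    discsOn u i                        ≡⟨ sym (+-identityʳ _) ⟩
    discsOn u i + ⟦ false ⟧            ≡⟨ cong (λ b → discsOn u i + ⟦ b ⟧) (sym (≢⇒eqᵇ-false (moved ∘ sym))) ⟩
    discsOn u i + ⟦ eqᵇ (lookup v d) i ⟧ ≡⟨ sym (discsOn-Move m i) ⟩
    discsOn v i + ⟦ eqᵇ i i ⟧          ≡⟨ cong (λ b → discsOn v i + ⟦ b ⟧) (eqᵇ-refl i) ⟩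
    discsOn v i + 1                    ≡⟨ +-comm _ 1 ⟩
    suc (discsOn v i) ∎
    where
    open ≡-Reasoning
    open Move m
    i = lookup u d

  discsOn-target : {u v : State p n} {d : Fin n} → Move u v d →
    discsOn v (lookup v d) ≡ suc (discsOn u (lookup v d))
  discsOn-target m = discsOn-source (Move-sym m)

emptyLoad occupiedLoad singletonLoad multitonLoad : ℕ → Bool
emptyLoad l = l ≡ᵇ 0
occupiedLoad l = not (l ≡ᵇ 0)
singletonLoad l = l ≡ᵇ 1
multitonLoad l = 2 ≤ᵇ l

load-classes : ∀ l → ⟦ multitonLoad l ⟧ + ⟦ singletonLoad l ⟧ ≡ ⟦ occupiedLoad l ⟧
load-classes zero = refl
load-classes (suc zero) = refl
load-classes (suc (suc l)) = refl

empty+occupied : ∀ l → ⟦ emptyLoad l ⟧ + ⟦ occupiedLoad l ⟧ ≡ 1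
empty+occupied zero = refl
empty+occupied (suc l) = refl

occupied∧singleton : ∀ l → occupiedLoad l ∧ singletonLoad l ≡ singletonLoad l
occupied∧singleton zero = refl
occupied∧singleton (suc l) = refl

occupied∧multiton : ∀ l → occupiedLoad l ∧ multitonLoad l ≡ multitonLoad l
occupied∧multiton zero = refl
occupied∧multiton (suc l) = refl

occupiedLoad-≥1 : {l : ℕ} → 1 ≤ l → occupiedLoad l ≡ true
occupiedLoad-≥1 (s≤s _) = refl

emptyLoad⇒≡0 : {l : ℕ} → emptyLoad l ≡ true → l ≡ 0
emptyLoad⇒≡0 {zero} _ = refl

module _ {p n : ℕ} where

  typedMove : (α β : ℕ → Bool) → State p n → State p n → Bool
  typedMove α β u v =
    any (λ d → movesDisc u v d ∧ α (load u (lookup u d)) ∧ β (load u (lookup v d))) (allFin n)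

  typedMove⇒Move : (α β : ℕ → Bool) {u v : State p n} → typedMove α β u v ≡ true → ∃ λ d → Move u v d
  typedMove⇒Move α β {u} {v} e with anyF-elim n (trans (sym (any-allFin n _)) e)
  ... | d , md = d , movesDisc⇒Move (∧-conicalˡ (movesDisc u v d) _ md)

  ΣS-typedMove : (α β : ℕ → Bool) (u : State p n) →
    ΣS p n (⟦_⟧ ∘ typedMove α β u)
      ≡ ΣF n (λ d → ΣF p (λ j → ⟦ canMove u d j ∧ α (discsOn u (lookup u d)) ∧ β (discsOn u j) ⟧))
  ΣS-typedMove α β u = begin
    ΣS p n (⟦_⟧ ∘ typedMove α β u)
      ≡⟨ ΣS-cong p n (λ v → trans (cong ⟦_⟧ (any-allFin n _)) (⟦anyF⟧≡ΣF n _ (unique v))) ⟩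
    ΣS p n (λ v → ΣF n (λ d → ⟦ movesDisc u v d ∧ X d (lookup v d) ⟧))
      ≡⟨ ΣL-ΣF-swap (allStates p n) n _ ⟩
    ΣF n (λ d → ΣS p n (λ v → ⟦ movesDisc u v d ∧ X d (lookup v d) ⟧))
      ≡⟨ ΣF-cong n (λ d → ΣS-cong p n (λ v → cong ⟦_⟧ (regroup v d))) ⟩
    ΣF n (λ d → ΣS p n (λ v → ⟦ agreeOff u v d ∧ canMove u d (lookup v d) ∧ X d (lookup v d) ⟧))
      ≡⟨ ΣF-cong n (λ d → ΣS-agreeOff u d (λ j → canMove u d j ∧ X d j)) ⟩
    ΣF n (λ d → ΣF p (λ j → ⟦ canMove u d j ∧ X d j ⟧))
      ≡⟨ ΣF-cong n (λ d → ΣF-cong p (λ j →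
           cong₂ (λ a b → ⟦ canMove u d j ∧ α a ∧ β b ⟧) (load≡discsOn u (lookup u d)) (load≡discsOn u j))) ⟩
    ΣF n (λ d → ΣF p (λ j → ⟦ canMove u d j ∧ α (discsOn u (lookup u d)) ∧ β (discsOn u j) ⟧)) ∎
    where
    open ≡-Reasoning
    X : Fin n → Fin p → Bool
    X d j = α (load u (lookup u d)) ∧ β (load u j)
    unique : (v : State p n) (d d' : Fin n) → movesDisc u v d ∧ X d (lookup v d) ≡ true →
             movesDisc u v d' ∧ X d' (lookup v d') ≡ true → d ≡ d'
    unique v d d' e e' =
      Move-unique {u = u} {v = v} (movesDisc⇒Move (∧-conicalˡ (movesDisc u v d) _ e))
                                  (movesDisc⇒Move (∧-conicalˡ (movesDisc u v d') _ e'))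
    regroup : (v : State p n) (d : Fin n) →
      movesDisc u v d ∧ X d (lookup v d) ≡ agreeOff u v d ∧ canMove u d (lookup v d) ∧ X d (lookup v d)
    regroup v d = trans (cong (_∧ X d (lookup v d)) (movesDisc≡ u v d)) (∧-assoc (agreeOff u v d) _ _)

  -- Reversing a move of type (α, β) gives a move of type (γ, δ), where A and B are
  -- the loads of the source and target pegs not counting the moved disc.
  typedMove-reverse : (α β γ δ : ℕ → Bool) →
    (∀ A B → α (suc A) ≡ true → β B ≡ true → (γ (suc B) ≡ true) × (δ A ≡ true)) →
    {u v : State p n} → typedMove α β u v ≡ true → typedMove γ δ v u ≡ true
  typedMove-reverse α β γ δ types {u} {v} e with anyF-elim n (trans (sym (any-allFin n _)) e)
  ... | d , md-αβ =
    trans (any-allFin n _)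
          (anyF-intro n d (cong₂ _∧_ (Move⇒movesDisc (Move-sym m)) (cong₂ _∧_ γ-target δ-source)))
    where
    md : movesDisc u v d ≡ true
    md = ∧-conicalˡ (movesDisc u v d) _ md-αβ
    αβ : α (load u (lookup u d)) ∧ β (load u (lookup v d)) ≡ true
    αβ = ∧-conicalʳ (movesDisc u v d) _ md-αβ
    m : Move u v d
    m = movesDisc⇒Move md
    A = discsOn v (lookup u d)
    B = discsOn u (lookup v d)
    α-source : α (suc A) ≡ true
    α-source = subst (λ l → α l ≡ true) (trans (load≡discsOn u (lookup u d)) (discsOn-source m))
                     (∧-conicalˡ (α (load u (lookup u d))) _ αβ)
    β-target : β B ≡ true
    β-target = subst (λ l → β l ≡ true) (load≡discsOn u (lookup v d))
                     (∧-conicalʳ (α (load u (lookup u d))) _ αβ)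
    γ-target : γ (load v (lookup v d)) ≡ true
    γ-target = subst (λ l → γ l ≡ true) (sym (trans (load≡discsOn v (lookup v d)) (discsOn-target m)))
                     (proj₁ (types A B α-source β-target))
    δ-source : δ (load v (lookup u d)) ≡ true
    δ-source = subst (λ l → δ l ≡ true) (sym (load≡discsOn v (lookup u d)))
                     (proj₂ (types A B α-source β-target))

reverse-S→E : ∀ A B → singletonLoad (suc A) ≡ true → emptyLoad B ≡ true →
  (singletonLoad (suc B) ≡ true) × (emptyLoad A ≡ true)
reverse-S→E zero zero _ _ = refl , refl

reverse-M→O : ∀ A B → multitonLoad (suc A) ≡ true → occupiedLoad B ≡ true →
  (multitonLoad (suc B) ≡ true) × (occupiedLoad A ≡ true)
reverse-M→O (suc A) (suc B) _ _ = refl , refl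

reverse-S→O : ∀ A B → singletonLoad (suc A) ≡ true → occupiedLoad B ≡ true →
  (multitonLoad (suc B) ≡ true) × (emptyLoad A ≡ true)
reverse-S→O zero (suc B) _ _ = refl , refl

reverse-M→E : ∀ A B → multitonLoad (suc A) ≡ true → emptyLoad B ≡ true →
  (singletonLoad (suc B) ≡ true) × (occupiedLoad A ≡ true)
reverse-M→E (suc A) zero _ _ = refl , refl

-- Top discs

module _ {p n : ℕ} where

  isTop : State p n → Fin n → Bool
  isTop u d = allF n (λ e → not (toℕ e <ᵇ toℕ d) ∨ not (eqᵇ (lookup u e) (lookup u d)))

  noSmallerOn : State p n → Fin n → Fin p → Bool
  noSmallerOn u d j = allF n (λ e → not (toℕ e <ᵇ toℕ d) ∨ not (eqᵇ (lookup u e) j))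

  unobstructed≡ : (u : State p n) (d : Fin n) (j : Fin p) → unobstructed u d j ≡ isTop u d ∧ noSmallerOn u d j
  unobstructed≡ u d j = trans (allF-cong n (λ e → ∨-distribˡ-∧ (not (toℕ e <ᵇ toℕ d)) _ _)) (allF-∧ n _ _)

  isTop⇒ : {u : State p n} {d : Fin n} → isTop u d ≡ true →
    ∀ e → (toℕ e <ᵇ toℕ d) ≡ true → eqᵇ (lookup u e) (lookup u d) ≡ false
  isTop⇒ {d = d} top e e<d = not-injective (∨-resolveˡ (allF-elim n top e) (cong not e<d))

ΣF-topOn : {p n : ℕ} (u : State p n) (i : Fin p) →
  ΣF n (λ d → ⟦ eqᵇ (lookup u d) i ∧ isTop u d ⟧) ≡ ⟦ occupiedLoad (discsOn u i) ⟧
ΣF-topOn {p} {zero} [] i = refl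
ΣF-topOn {p} {suc n} (a ∷ u) i with eqᵇ a i in a≡i
... | true = cong₂ _+_ (cong ⟦_⟧ (allF-intro n (λ _ → refl))) (ΣF-0 n (λ d → cong ⟦_⟧ (covered d)))
  where
  covered : (d : Fin n) → eqᵇ (lookup u d) i ∧ not (eqᵇ a (lookup u d)) ∧ isTop u d ≡ false
  covered d with eqᵇ (lookup u d) i in d≡i
  ... | false = refl
  ... | true = cong (λ b → not b ∧ isTop u d) (trans (cong (eqᵇ a) (eqᵇ⇒≡ d≡i)) a≡i)
... | false = trans (ΣF-cong n (λ d → cong ⟦_⟧ (uncovered d))) (ΣF-topOn u i)
  where
  uncovered : (d : Fin n) →
    eqᵇ (lookup u d) i ∧ not (eqᵇ a (lookup u d)) ∧ isTop u d ≡ eqᵇ (lookup u d) i ∧ isTop u d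
  uncovered d with eqᵇ (lookup u d) i in d≡i
  ... | false = refl
  ... | true = cong (λ b → not b ∧ isTop u d) (trans (cong (eqᵇ a) (eqᵇ⇒≡ d≡i)) a≡i)

ΣF-tops : {p n : ℕ} (u : State p n) (g : Fin p → ℕ) →
  ΣF n (λ d → ⟦ isTop u d ⟧ * g (lookup u d)) ≡ ΣF p (λ i → ⟦ occupiedLoad (discsOn u i) ⟧ * g i)
ΣF-tops {p} {n} u g = begin
  ΣF n (λ d → ⟦ isTop u d ⟧ * g (lookup u d))
    ≡⟨ ΣF-cong n (λ d → sym (ΣF-delta p (lookup u d) (λ i → ⟦ isTop u d ⟧ * g i))) ⟩
  ΣF n (λ d → ΣF p (λ i → ⟦ eqᵇ (lookup u d) i ⟧ * (⟦ isTop u d ⟧ * g i)))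
    ≡⟨ ΣF-swap n p _ ⟩
  ΣF p (λ i → ΣF n (λ d → ⟦ eqᵇ (lookup u d) i ⟧ * (⟦ isTop u d ⟧ * g i)))
    ≡⟨ ΣF-cong p (λ i → trans (ΣF-cong n (λ d → trans (sym (*-assoc ⟦ eqᵇ (lookup u d) i ⟧ _ (g i)))
                                                      (cong (_* g i) (sym (⟦∧⟧ (eqᵇ (lookup u d) i) _)))))
                              (ΣF-*ʳ n (g i) _)) ⟩
  ΣF p (λ i → ΣF n (λ d → ⟦ eqᵇ (lookup u d) i ∧ isTop u d ⟧) * g i)
    ≡⟨ ΣF-cong p (λ i → cong (_* g i) (ΣF-topOn u i)) ⟩
  ΣF p (λ i → ⟦ occupiedLoad (discsOn u i) ⟧ * g i) ∎
  where open ≡-Reasoning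

-- The census of a state

module Census {p n : ℕ} (u : State p n) where

  μ ν M E : ℕ
  μ = ΣF p (λ i → ⟦ occupiedLoad (discsOn u i) ⟧)
  ν = ΣF p (λ i → ⟦ singletonLoad (discsOn u i) ⟧)
  M = ΣF p (λ i → ⟦ multitonLoad (discsOn u i) ⟧)
  E = ΣF p (λ i → ⟦ emptyLoad (discsOn u i) ⟧)

  occupancy≡μ : occupancy u ≡ μ
  occupancy≡μ = trans (countᵇ≡ΣL _ (allFin p))
    (trans (ΣL-allFin p _) (ΣF-cong p (λ i → cong (⟦_⟧ ∘ occupiedLoad) (load≡discsOn u i))))

  singletons≡ν : singletons u ≡ ν
  singletons≡ν = trans (countᵇ≡ΣL _ (allFin p))
    (trans (ΣL-allFin p _) (ΣF-cong p (λ i → cong (⟦_⟧ ∘ singletonLoad) (load≡discsOn u i))))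

  M+ν≡μ : M + ν ≡ μ
  M+ν≡μ = trans (sym (ΣF-+ p _ _)) (ΣF-cong p (λ i → load-classes (discsOn u i)))

  E+μ≡p : E + μ ≡ p
  E+μ≡p = trans (sym (ΣF-+ p _ _)) (trans (ΣF-cong p (λ i → empty+occupied (discsOn u i))) (ΣF-1 p))

  μ≡tops : μ ≡ ΣF n (λ d → ⟦ isTop u d ⟧)
  μ≡tops = sym (trans (ΣF-cong n (λ d → sym (*-identityʳ _)))
                      (trans (ΣF-tops u (λ _ → 1)) (ΣF-cong p (λ i → *-identityʳ _))))

  ν≤μ : ν ≤ μ
  ν≤μ = subst (ν ≤_) M+ν≡μ (m≤n+m ν M)

  μ≤p : μ ≤ p
  μ≤p = ΣF-⟦⟧≤ p _

  μ≤n : μ ≤ n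
  μ≤n = subst (_≤ n) (sym μ≡tops) (ΣF-⟦⟧≤ n _)

  sourceOccupied : (d : Fin n) → occupiedLoad (discsOn u (lookup u d)) ≡ true
  sourceOccupied d = occupiedLoad-≥1 (subst (λ b → ⟦ b ⟧ ≤ discsOn u (lookup u d)) (eqᵇ-refl (lookup u d))
                                            (≤-ΣF n (λ e → ⟦ eqᵇ (lookup u e) (lookup u d) ⟧) d))

  emptyPeg : {j : Fin p} → emptyLoad (discsOn u j) ≡ true → (e : Fin n) → eqᵇ (lookup u e) j ≡ false
  emptyPeg {j} j-empty e = ⟦⟧≡0 (n≤0⇒n≡0 (subst (⟦ eqᵇ (lookup u e) j ⟧ ≤_) (emptyLoad⇒≡0 j-empty)
                                                       (≤-ΣF n (λ e → ⟦ eqᵇ (lookup u e) j ⟧) e)))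

  canMove-toEmpty : (d : Fin n) {j : Fin p} → emptyLoad (discsOn u j) ≡ true → canMove u d j ≡ isTop u d
  canMove-toEmpty d {j} j-empty = begin
    not (eqᵇ (lookup u d) j) ∧ unobstructed u d j
      ≡⟨ cong₂ _∧_ (cong not (emptyPeg j-empty d)) (unobstructed≡ u d j) ⟩
    isTop u d ∧ noSmallerOn u d j
      ≡⟨ cong (isTop u d ∧_) (allF-intro n (λ e →
           trans (cong (λ b → not (toℕ e <ᵇ toℕ d) ∨ not b) (emptyPeg j-empty e)) (∨-zeroʳ _))) ⟩
    isTop u d ∧ true
      ≡⟨ ∧-identityʳ (isTop u d) ⟩
    isTop u d ∎
    where open ≡-Reasoning

  movesToEmpty : (s : ℕ → Bool) →
    ΣF n (λ d → ΣF p (λ j → ⟦ canMove u d j ∧ s (discsOn u (lookup u d)) ∧ emptyLoad (discsOn u j) ⟧))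
      ≡ ΣF p (λ i → ⟦ occupiedLoad (discsOn u i) ∧ s (discsOn u i) ⟧) * E
  movesToEmpty s = begin
    ΣF n (λ d → ΣF p (λ j → ⟦ canMove u d j ∧ s (source d) ∧ emptyLoad (discsOn u j) ⟧))
      ≡⟨ ΣF-cong n (λ d → ΣF-cong p (λ j →
           trans (cong ⟦_⟧ (∧-congˡ-when (s (source d)) _ (canMove-toEmpty d)))
                 (⟦∧∧⟧ (isTop u d) (s (source d)) _))) ⟩
    ΣF n (λ d → ΣF p (λ j → ⟦ isTop u d ⟧ * (⟦ s (source d) ⟧ * ⟦ emptyLoad (discsOn u j) ⟧)))
      ≡⟨ ΣF-cong n (λ d → trans (ΣF-*ˡ p ⟦ isTop u d ⟧ _)
                                (cong (⟦ isTop u d ⟧ *_) (ΣF-*ˡ p ⟦ s (source d) ⟧ _))) ⟩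
    ΣF n (λ d → ⟦ isTop u d ⟧ * (⟦ s (source d) ⟧ * E))
      ≡⟨ ΣF-tops u (λ i → ⟦ s (discsOn u i) ⟧ * E) ⟩
    ΣF p (λ i → ⟦ occupiedLoad (discsOn u i) ⟧ * (⟦ s (discsOn u i) ⟧ * E))
      ≡⟨ ΣF-cong p (λ i → trans (sym (*-assoc ⟦ occupiedLoad (discsOn u i) ⟧ _ E))
                                  (cong (_* E) (sym (⟦∧⟧ (occupiedLoad (discsOn u i)) (s (discsOn u i)))))) ⟩
    ΣF p (λ i → ⟦ occupiedLoad (discsOn u i) ∧ s (discsOn u i) ⟧ * E)
      ≡⟨ ΣF-*ʳ p E _ ⟩
    ΣF p (λ i → ⟦ occupiedLoad (discsOn u i) ∧ s (discsOn u i) ⟧) * E ∎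
    where
    open ≡-Reasoning
    source : Fin n → ℕ
    source d = discsOn u (lookup u d)

  movesS→E : ΣS p n (⟦_⟧ ∘ typedMove singletonLoad emptyLoad u) ≡ ν * E
  movesS→E = trans (ΣS-typedMove singletonLoad emptyLoad u) (trans (movesToEmpty singletonLoad)
    (cong (_* E) (ΣF-cong p (λ i → cong ⟦_⟧ (occupied∧singleton (discsOn u i))))))

  movesM→E : ΣS p n (⟦_⟧ ∘ typedMove multitonLoad emptyLoad u) ≡ M * E
  movesM→E = trans (ΣS-typedMove multitonLoad emptyLoad u) (trans (movesToEmpty multitonLoad)
    (cong (_* E) (ΣF-cong p (λ i → cong ⟦_⟧ (occupied∧multiton (discsOn u i))))))

  toOccupied : ℕ
  toOccupied = ΣF n (λ d → ΣF p (λ j → ⟦ canMove u d j ∧ occupiedLoad (discsOn u j) ⟧))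

  movesM→O+S→O : ΣS p n (⟦_⟧ ∘ typedMove multitonLoad occupiedLoad u)
                 + ΣS p n (⟦_⟧ ∘ typedMove singletonLoad occupiedLoad u) ≡ toOccupied
  movesM→O+S→O =
    trans (cong₂ _+_ (ΣS-typedMove multitonLoad occupiedLoad u) (ΣS-typedMove singletonLoad occupiedLoad u))
          (trans (sym (ΣF-+ n _ _)) (ΣF-cong n (λ d → trans (sym (ΣF-+ p _ _)) (ΣF-cong p (λ j →
            ⟦∧-split⟧ (canMove u d j) _ _ (occupiedLoad (discsOn u j))
                      (trans (load-classes (discsOn u (lookup u d))) (cong ⟦_⟧ (sourceOccupied d))))))))
    where
    ⟦∧-split⟧ : ∀ c m s o → ⟦ m ⟧ + ⟦ s ⟧ ≡ 1 → ⟦ c ∧ m ∧ o ⟧ + ⟦ c ∧ s ∧ o ⟧ ≡ ⟦ c ∧ o ⟧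
    ⟦∧-split⟧ false m s o _ = refl
    ⟦∧-split⟧ true true false o _ = +-identityʳ ⟦ o ⟧
    ⟦∧-split⟧ true false true o _ = refl

  pairOrder : (d d' : Fin n) → isTop u d ≡ true → isTop u d' ≡ true →
    not (eqᵇ (lookup u d) (lookup u d')) ∧ noSmallerOn u d (lookup u d') ≡ (toℕ d <ᵇ toℕ d')
  pairOrder d d' top top' with toℕ d <ᵇ toℕ d' in d<d'
  ... | true = cong₂ _∧_ (cong not (isTop⇒ {u = u} {d = d'} top' d d<d')) (allF-intro n off-peg)
    where
    off-peg : ∀ e → not (toℕ e <ᵇ toℕ d) ∨ not (eqᵇ (lookup u e) (lookup u d')) ≡ true
    off-peg e with toℕ e <ᵇ toℕ d in e<d
    ... | false = refl
    ... | true = cong not (isTop⇒ {u = u} {d = d'} top' e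
                   (<⇒<ᵇ-true (<-trans (<ᵇ-true⇒< (toℕ e) (toℕ d) e<d)
                                       (<ᵇ-true⇒< (toℕ d) (toℕ d') d<d'))))
  ... | false with d ≟ d'
  ... | yes refl = cong (λ b → not b ∧ noSmallerOn u d (lookup u d)) (eqᵇ-refl (lookup u d))
  ... | no d≢d' =
    trans (cong (not (eqᵇ (lookup u d) (lookup u d')) ∧_) (allF-false n _ d' d'-below)) (∧-zeroʳ _)
    where
    d'<d : toℕ d' < toℕ d
    d'<d = ≤∧≢⇒< (<ᵇ-false⇒≥ d<d') (λ eq → d≢d' (Fin.toℕ-injective (sym eq)))
    d'-below : not (toℕ d' <ᵇ toℕ d) ∨ not (eqᵇ (lookup u d') (lookup u d')) ≡ false
    d'-below = cong₂ (λ a b → not a ∨ not b) (<⇒<ᵇ-true d'<d) (eqᵇ-refl (lookup u d'))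

  top : Fin n → ℕ
  top d = ⟦ isTop u d ⟧

  toOccupied≡pairs : toOccupied ≡ ΣF n (λ d → ΣF n (λ d' → ⟦ toℕ d <ᵇ toℕ d' ⟧ * (top d * top d')))
  toOccupied≡pairs = begin
    ΣF n (λ d → ΣF p (λ j → ⟦ canMove u d j ∧ occupiedLoad (discsOn u j) ⟧))
      ≡⟨ ΣF-cong n (λ d → trans (ΣF-cong p (λ j → trans (cong ⟦_⟧ (rearrange d j))
                                                       (⟦∧∧⟧ (isTop u d) (occupiedLoad (discsOn u j)) (onto d j))))
                                (ΣF-*ˡ p (top d) _)) ⟩
    ΣF n (λ d → top d * ΣF p (λ j → ⟦ occupiedLoad (discsOn u j) ⟧ * ⟦ onto d j ⟧))
      ≡⟨ ΣF-cong n (λ d → cong (top d *_) (sym (ΣF-tops u (λ j → ⟦ onto d j ⟧)))) ⟩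
    ΣF n (λ d → top d * ΣF n (λ d' → top d' * ⟦ onto d (lookup u d') ⟧))
      ≡⟨ ΣF-cong n (λ d → trans (sym (ΣF-*ˡ n (top d) _)) (ΣF-cong n (ordered d))) ⟩
    ΣF n (λ d → ΣF n (λ d' → ⟦ toℕ d <ᵇ toℕ d' ⟧ * (top d * top d'))) ∎
    where
    open ≡-Reasoning
    onto : Fin n → Fin p → Bool
    onto d j = not (eqᵇ (lookup u d) j) ∧ noSmallerOn u d j
    rearrange : (d : Fin n) (j : Fin p) →
      canMove u d j ∧ occupiedLoad (discsOn u j) ≡ isTop u d ∧ occupiedLoad (discsOn u j) ∧ onto d j
    rearrange d j = trans (cong (λ b → (not (eqᵇ (lookup u d) j) ∧ b) ∧ occupiedLoad (discsOn u j))
                                (unobstructed≡ u d j))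
                          (∧-rearrange (not (eqᵇ (lookup u d) j)) (isTop u d) _ (occupiedLoad (discsOn u j)))
      where
      ∧-rearrange : ∀ a t f o → (a ∧ t ∧ f) ∧ o ≡ t ∧ o ∧ a ∧ f
      ∧-rearrange a t f false = trans (∧-zeroʳ _) (sym (∧-zeroʳ t))
      ∧-rearrange true t f true = ∧-identityʳ (t ∧ f)
      ∧-rearrange false t f true = sym (∧-zeroʳ t)
    ordered : (d d' : Fin n) →
      top d * (top d' * ⟦ onto d (lookup u d') ⟧) ≡ ⟦ toℕ d <ᵇ toℕ d' ⟧ * (top d * top d')
    ordered d d' with isTop u d in t | isTop u d' in t'
    ... | true | true = trans (cong (λ b → 1 * (1 * ⟦ b ⟧)) (pairOrder d d' t t'))
                              (trans (*-identityˡ _) (trans (*-identityˡ _) (sym (*-identityʳ _))))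
    ... | true | false = sym (*-zeroʳ ⟦ toℕ d <ᵇ toℕ d' ⟧)
    ... | false | _ = sym (*-zeroʳ ⟦ toℕ d <ᵇ toℕ d' ⟧)

  2*toOccupied+μ≡μ² : 2 * toOccupied + μ ≡ μ * μ
  2*toOccupied+μ≡μ² = begin
    2 * toOccupied + μ
      ≡⟨ cong₂ (λ x y → 2 * x + y) toOccupied≡pairs
               (trans μ≡tops (ΣF-cong n (λ d → sym (⟦⟧-idem (isTop u d))))) ⟩
    2 * ΣF n (λ d → ΣF n (λ d' → ⟦ toℕ d <ᵇ toℕ d' ⟧ * (top d * top d'))) + ΣF n (λ d → top d * top d)
      ≡⟨ sym (ΣF-square n top) ⟩
    ΣF n top * ΣF n top
      ≡⟨ cong₂ _*_ (sym μ≡tops) (sym μ≡tops) ⟩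
    μ * μ ∎
    where open ≡-Reasoning

-- Edges

base-digits-injective : {p : ℕ} (x y : Fin p) (a b : ℕ) →
  toℕ x + p * a ≡ toℕ y + p * b → x ≡ y × a ≡ b
base-digits-injective {p} x y a b e =
  Fin.toℕ-injective x≡y ,
  *-cancelˡ-≡ a b p (+-cancelˡ-≡ (toℕ x) _ _ (trans e (cong (_+ p * b) (sym x≡y))))
  where
  instance
    p≢0 : NonZero p
    p≢0 = >-nonZero (≤-trans (s≤s z≤n) (Fin.toℕ<n x))
  digit : (z : Fin p) (c : ℕ) → (toℕ z + p * c) % p ≡ toℕ z
  digit z c = trans (cong (λ k → (toℕ z + k) % p) (*-comm p c))
                    (trans ([m+kn]%n≡m%n (toℕ z) c p) (m<n⇒m%n≡m (Fin.toℕ<n z)))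
  x≡y : toℕ x ≡ toℕ y
  x≡y = trans (sym (digit x a)) (trans (cong (_% p) e) (digit y b))

code-injective : {p q : ℕ} (u v : Vec (Fin p) q) → code u ≡ code v → u ≡ v
code-injective [] [] _ = refl
code-injective (x ∷ u) (y ∷ v) e with base-digits-injective x y (code u) (code v) e
... | refl , same-rest = cong (x ∷_) (code-injective u v same-rest)

module _ {p n : ℕ} where

  -- Each edge is listed once in 'edges', oriented by 'code'; ordered pairs count it twice.
  countᵇ-edges-twice : (inE : State p n × State p n → Bool) (mv : State p n → State p n → Bool) →
    (∀ u v → inE (u , v) ≡ mv u v) → (∀ u v → mv u v ≡ mv v u) →
    (∀ u v → mv u v ≡ true → adjacent u v ≡ true) → (∀ u v → mv u v ≡ true → u ≢ v) →
    countᵇ inE (edges p n) + countᵇ inE (edges p n) ≡ ΣS² p n mv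
  countᵇ-edges-twice inE mv inE≡mv mv-sym mv⇒adjacent mv⇒≢ = begin
    C + C
      ≡⟨ cong₂ _+_ C≡ (trans C≡ swapped) ⟩
    ΣS p n (λ u → ΣS p n (upward u)) + ΣS p n (λ u → ΣS p n (downward u))
      ≡⟨ sym (ΣL-+ S _ _) ⟩
    ΣS p n (λ u → ΣS p n (upward u) + ΣS p n (downward u))
      ≡⟨ ΣS-cong p n (λ u → trans (sym (ΣL-+ S _ _)) (ΣS-cong p n (both-directions u))) ⟩
    ΣS² p n mv ∎
    where
    open ≡-Reasoning
    S = allStates p n
    C = countᵇ inE (edges p n)
    upward downward : State p n → State p n → ℕ
    upward u v = ⟦ (code u <ᵇ code v) ∧ mv u v ⟧
    downward u v = ⟦ (code v <ᵇ code u) ∧ mv u v ⟧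
    C≡ : C ≡ ΣS p n (λ u → ΣS p n (upward u))
    C≡ = trans (countᵇ-filterᵇ _ inE (cartesianProduct S S)) (trans (ΣL-cartesianProduct S S _)
           (ΣS-cong p n (λ u → ΣS-cong p n (λ v → cong ⟦_⟧ (
             trans (∧-assoc (code u <ᵇ code v) (adjacent u v) (inE (u , v)))
                   (cong ((code u <ᵇ code v) ∧_) (adjacent-absorbed u v)))))))
      where
      adjacent-absorbed : ∀ u v → adjacent u v ∧ inE (u , v) ≡ mv u v
      adjacent-absorbed u v rewrite inE≡mv u v with mv u v in m
      ... | true = cong (_∧ true) (mv⇒adjacent u v m)
      ... | false = ∧-zeroʳ (adjacent u v)
    swapped : ΣS p n (λ u → ΣS p n (upward u)) ≡ ΣS p n (λ u → ΣS p n (downward u))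
    swapped = trans (ΣL-swap S S _) (ΣS-cong p n (λ u → ΣS-cong p n (λ v →
                cong (λ b → ⟦ (code v <ᵇ code u) ∧ b ⟧) (mv-sym v u))))
    both-directions : (u v : State p n) → upward u v + downward u v ≡ ⟦ mv u v ⟧
    both-directions u v with mv u v in m
    ... | false = cong₂ _+_ (cong ⟦_⟧ (∧-zeroʳ (code u <ᵇ code v))) (cong ⟦_⟧ (∧-zeroʳ (code v <ᵇ code u)))
    ... | true = trans (cong₂ (λ a b → ⟦ a ⟧ + ⟦ b ⟧) (∧-identityʳ (code u <ᵇ code v)) (∧-identityʳ (code v <ᵇ code u)))
                       (<ᵇ-dichotomy (code u) (code v) (mv⇒≢ u v m ∘ code-injective u v))

  typedMove-sym : (α β : ℕ → Bool) →
    (∀ A B → α (suc A) ≡ true → β B ≡ true → (α (suc B) ≡ true) × (β A ≡ true)) →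
    (u v : State p n) → typedMove α β u v ≡ typedMove α β v u
  typedMove-sym α β self-reverse u v =
    ⇔→≡ {z = true} (mk⇔ (typedMove-reverse α β α β self-reverse {u} {v})
                        (typedMove-reverse α β α β self-reverse {v} {u}))

  typedMove⇒adjacent : (α β : ℕ → Bool) (u v : State p n) → typedMove α β u v ≡ true → adjacent u v ≡ true
  typedMove⇒adjacent α β u v e with typedMove⇒Move α β {u} {v} e
  ... | d , m = trans (any-allFin n _) (anyF-intro n d (Move⇒movesDisc m))

  typedMove⇒≢ : (α β : ℕ → Bool) (u v : State p n) → typedMove α β u v ≡ true → u ≢ v
  typedMove⇒≢ α β u v e = Move⇒≢ (proj₂ (typedMove⇒Move α β e))

  twiceCardE₁ : cardE₁ p n + cardE₁ p n ≡ ΣS² p n (typedMove singletonLoad emptyLoad)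
  twiceCardE₁ = countᵇ-edges-twice inE₁ move₁ inE₁≡move₁ move₁-sym
                  (typedMove⇒adjacent singletonLoad emptyLoad) (typedMove⇒≢ singletonLoad emptyLoad)
    where
    move₁-sym : ∀ u v → move₁ u v ≡ move₁ v u
    move₁-sym = typedMove-sym singletonLoad emptyLoad reverse-S→E
    inE₁≡move₁ : ∀ u v → inE₁ (u , v) ≡ move₁ u v
    inE₁≡move₁ u v with occupancy u ≤ᵇ occupancy v
    ... | true = refl
    ... | false = move₁-sym v u

  twiceCardE₂ : cardE₂ p n + cardE₂ p n ≡ ΣS² p n (typedMove multitonLoad occupiedLoad)
  twiceCardE₂ = countᵇ-edges-twice inE₂ move₂ inE₂≡move₂ move₂-sym
                  (typedMove⇒adjacent multitonLoad occupiedLoad) (typedMove⇒≢ multitonLoad occupiedLoad)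
    where
    move₂-sym : ∀ u v → move₂ u v ≡ move₂ v u
    move₂-sym = typedMove-sym multitonLoad occupiedLoad reverse-M→O
    inE₂≡move₂ : ∀ u v → inE₂ (u , v) ≡ move₂ u v
    inE₂≡move₂ u v with occupancy u ≤ᵇ occupancy v
    ... | true = refl
    ... | false = move₂-sym v u

  -- Reversal is a bijection between S→O and M→E moves.
  ΣS²-S→O≡M→E : ΣS² p n (typedMove singletonLoad occupiedLoad)
                ≡ ΣS² p n (typedMove multitonLoad emptyLoad)
  ΣS²-S→O≡M→E = trans (ΣS-cong p n (λ u → ΣS-cong p n (λ v → cong ⟦_⟧ (reversed {u} {v}))))
                        (ΣL-swap (allStates p n) (allStates p n) _)
    where
    reversed : ∀ {u v} → typedMove singletonLoad occupiedLoad u v ≡ typedMove multitonLoad emptyLoad v u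
    reversed {u} {v} = ⇔→≡ {z = true} (mk⇔
      (typedMove-reverse singletonLoad occupiedLoad multitonLoad emptyLoad reverse-S→O {u} {v})
      (typedMove-reverse multitonLoad emptyLoad singletonLoad occupiedLoad reverse-M→E {v} {u}))

module Counts (p n : ℕ) where
  open Census

  twiceCardE₁≡ : cardE₁ p n + cardE₁ p n ≡ ΣS p n (λ u → ν u * E u)
  twiceCardE₁≡ = trans (twiceCardE₁ {p} {n}) (ΣS-cong p n movesS→E)

  twiceCardE₂+ME≡ : cardE₂ p n + cardE₂ p n + ΣS p n (λ u → M u * E u) ≡ ΣS p n toOccupied
  twiceCardE₂+ME≡ = begin
    cardE₂ p n + cardE₂ p n + ΣS p n (λ u → M u * E u)
      ≡⟨ cong₂ _+_ (twiceCardE₂ {p} {n}) (sym (trans (ΣS²-S→O≡M→E {p} {n}) (ΣS-cong p n movesM→E))) ⟩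
    ΣS² p n (typedMove multitonLoad occupiedLoad) + ΣS² p n (typedMove singletonLoad occupiedLoad)
      ≡⟨ sym (ΣL-+ (allStates p n) _ _) ⟩
    ΣS p n (λ u → ΣS p n (⟦_⟧ ∘ typedMove multitonLoad occupiedLoad u)
                  + ΣS p n (⟦_⟧ ∘ typedMove singletonLoad occupiedLoad u))
      ≡⟨ ΣS-cong p n movesM→O+S→O ⟩
    ΣS p n toOccupied ∎
    where open ≡-Reasoning

  fourCardE₂≡ : 4 * cardE₂ p n + ΣS p n (λ u → 2 * (M u * E u) + μ u) ≡ ΣS p n (λ u → μ u * μ u)
  fourCardE₂≡ = begin
    4 * e₂ + ΣS p n (λ u → 2 * (M u * E u) + μ u)
      ≡⟨ cong (_+_ (4 * e₂)) (trans (ΣL-+ S _ μ) (cong (_+ ΣS p n μ) (ΣS-*ˡ p n 2 _))) ⟩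
    4 * e₂ + (2 * me + ΣS p n μ)
      ≡⟨ regroup e₂ me (ΣS p n μ) ⟩
    2 * (e₂ + e₂ + me) + ΣS p n μ
      ≡⟨ cong (λ x → 2 * x + ΣS p n μ) twiceCardE₂+ME≡ ⟩
    2 * ΣS p n toOccupied + ΣS p n μ
      ≡⟨ cong (_+ ΣS p n μ) (sym (ΣS-*ˡ p n 2 toOccupied)) ⟩
    ΣS p n (λ u → 2 * toOccupied u) + ΣS p n μ
      ≡⟨ sym (ΣL-+ S _ μ) ⟩
    ΣS p n (λ u → 2 * toOccupied u + μ u)
      ≡⟨ ΣS-cong p n 2*toOccupied+μ≡μ² ⟩
    ΣS p n (λ u → μ u * μ u) ∎
    where
    open ≡-Reasoning
    S = allStates p n
    e₂ = cardE₂ p n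
    me = ΣS p n (λ u → M u * E u)
    regroup : ∀ a b c → 4 * a + (2 * b + c) ≡ 2 * (a + a + b) + c
    regroup = ℕ-Solver.solve-∀

  fourCardE₁₂≡ : 4 * (cardE₁ p n + cardE₂ p n) + ΣS p n (λ u → 2 * (M u * E u) + μ u)
               ≡ ΣS p n (λ u → μ u * μ u + 2 * (ν u * E u))
  fourCardE₁₂≡ = begin
    4 * (e₁ + e₂) + X
      ≡⟨ regroup e₁ e₂ X ⟩
    2 * (e₁ + e₁) + (4 * e₂ + X)
      ≡⟨ cong₂ (λ a b → 2 * a + b) twiceCardE₁≡ fourCardE₂≡ ⟩
    2 * ΣS p n (λ u → ν u * E u) + ΣS p n (λ u → μ u * μ u)
      ≡⟨ trans (+-comm (2 * ΣS p n νE) _)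
               (cong (_+_ (ΣS p n (λ u → μ u * μ u))) (sym (ΣS-*ˡ p n 2 νE))) ⟩
    ΣS p n (λ u → μ u * μ u) + ΣS p n (λ u → 2 * (ν u * E u))
      ≡⟨ sym (ΣL-+ (allStates p n) _ _) ⟩
    ΣS p n (λ u → μ u * μ u + 2 * (ν u * E u)) ∎
    where
    open ≡-Reasoning
    e₁ = cardE₁ p n
    e₂ = cardE₂ p n
    X = ΣS p n (λ u → 2 * (M u * E u) + μ u)
    νE : State p n → ℕ
    νE u = ν u * E u
    regroup : ∀ a b c → 4 * (a + b) + c ≡ 2 * (a + a) + (4 * b + c)
    regroup = ℕ-Solver.solve-∀

-- Integer sums and grouping by (μ, ν)

ΣLℤ : {A : Set} → List A → (A → ℤ) → ℤ
ΣLℤ [] f = + 0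
ΣLℤ (x ∷ xs) f = f x ℤ.+ ΣLℤ xs f

ΣLℤ-cong : {A : Set} (xs : List A) {f g : A → ℤ} → (∀ x → f x ≡ g x) → ΣLℤ xs f ≡ ΣLℤ xs g
ΣLℤ-cong [] eq = refl
ΣLℤ-cong (x ∷ xs) eq = cong₂ ℤ._+_ (eq x) (ΣLℤ-cong xs eq)

ΣLℤ-0 : {A : Set} (xs : List A) → ΣLℤ xs (λ _ → + 0) ≡ + 0
ΣLℤ-0 [] = refl
ΣLℤ-0 (x ∷ xs) = trans (ℤ.+-identityˡ _) (ΣLℤ-0 xs)

ΣLℤ-+ : {A : Set} (xs : List A) (f g : A → ℤ) → ΣLℤ xs (λ x → f x ℤ.+ g x) ≡ ΣLℤ xs f ℤ.+ ΣLℤ xs g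
ΣLℤ-+ [] f g = refl
ΣLℤ-+ (x ∷ xs) f g = trans (cong (ℤ._+_ (f x ℤ.+ g x)) (ΣLℤ-+ xs f g)) (ℤ-interchange (f x) (g x) _ _)

ΣLℤ-*ˡ : {A : Set} (xs : List A) (c : ℤ) (f : A → ℤ) → ΣLℤ xs (λ x → c ℤ.* f x) ≡ c ℤ.* ΣLℤ xs f
ΣLℤ-*ˡ [] c f = sym (ℤ.*-zeroʳ c)
ΣLℤ-*ˡ (x ∷ xs) c f = trans (cong (ℤ._+_ (c ℤ.* f x)) (ΣLℤ-*ˡ xs c f)) (sym (ℤ.*-distribˡ-+ c (f x) _))

ΣLℤ-ΣL : {A : Set} (xs : List A) (f : A → ℕ) → + ΣL xs f ≡ ΣLℤ xs (+_ ∘ f)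
ΣLℤ-ΣL [] f = refl
ΣLℤ-ΣL (x ∷ xs) f = trans (ℤ.pos-+ (f x) _) (cong (ℤ._+_ (+ f x)) (ΣLℤ-ΣL xs f))

pos-subtract : ∀ a b {c} → a + b ≡ c → + a ≡ + c - + b
pos-subtract a b refl = sym (begin
  + (a + b) - + b              ≡⟨ cong (ℤ._- + b) (ℤ.pos-+ a b) ⟩
  (+ a ℤ.+ + b) - + b          ≡⟨ ℤ.+-assoc (+ a) (+ b) (ℤ.- + b) ⟩
  + a ℤ.+ (+ b - + b)          ≡⟨ cong (ℤ._+_ (+ a)) (ℤ.+-inverseʳ (+ b)) ⟩
  + a ℤ.+ + 0                  ≡⟨ ℤ.+-identityʳ (+ a) ⟩
  + a ∎)
  where open ≡-Reasoning

ΣL-difference : {A : Set} (xs : List A) (a : ℕ) (f g : A → ℕ) → a + ΣL xs g ≡ ΣL xs f →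
  + a ≡ ΣLℤ xs (λ x → + f x - + g x)
ΣL-difference xs a f g a+g≡f = begin
  + a                                   ≡⟨ pos-subtract a (ΣL xs g) a+g≡f ⟩
  + ΣL xs f - + ΣL xs g                 ≡⟨ cong₂ _-_ (ΣLℤ-ΣL xs f) (ΣLℤ-ΣL xs g) ⟩
  ΣLℤ xs (+_ ∘ f) - ΣLℤ xs (+_ ∘ g)     ≡⟨ sym (ΣLℤ-sub xs (+_ ∘ f) (+_ ∘ g)) ⟩
  ΣLℤ xs (λ x → + f x - + g x) ∎
  where
  open ≡-Reasoning
  ΣLℤ-sub : (ys : List _) (f g : _ → ℤ) → ΣLℤ ys (λ x → f x - g x) ≡ ΣLℤ ys f - ΣLℤ ys g
  ΣLℤ-sub [] f g = refl
  ΣLℤ-sub (x ∷ ys) f g = trans (cong (ℤ._+_ (f x - g x)) (ΣLℤ-sub ys f g)) (sub-interchange (f x) (g x) _ _)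
    where
    sub-interchange : ∀ a b c d → (a - b) ℤ.+ (c - d) ≡ (a ℤ.+ c) - (b ℤ.+ d)
    sub-interchange = ℤ-Solver.solve-∀

Σℤ : ℕ → (ℕ → ℤ) → ℤ
Σℤ zero f = + 0
Σℤ (suc m) f = f 0 ℤ.+ Σℤ m (f ∘ suc)

Σℤ-cong : (m : ℕ) {f g : ℕ → ℤ} → (∀ i → f i ≡ g i) → Σℤ m f ≡ Σℤ m g
Σℤ-cong zero eq = refl
Σℤ-cong (suc m) eq = cong₂ ℤ._+_ (eq 0) (Σℤ-cong m (eq ∘ suc))

Σℤ-0 : (m : ℕ) {f : ℕ → ℤ} → (∀ i → f i ≡ + 0) → Σℤ m f ≡ + 0
Σℤ-0 zero eq = refl
Σℤ-0 (suc m) eq = cong₂ ℤ._+_ (eq 0) (Σℤ-0 m (eq ∘ suc))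

Σℤ-ΣLℤ-swap : {A : Set} (m : ℕ) (xs : List A) (f : ℕ → A → ℤ) →
  Σℤ m (λ i → ΣLℤ xs (f i)) ≡ ΣLℤ xs (λ x → Σℤ m (λ i → f i x))
Σℤ-ΣLℤ-swap zero xs f = sym (ΣLℤ-0 xs)
Σℤ-ΣLℤ-swap (suc m) xs f =
  trans (cong (ℤ._+_ (ΣLℤ xs (f 0))) (Σℤ-ΣLℤ-swap m xs (f ∘ suc))) (sym (ΣLℤ-+ xs _ _))

Σℤ-delta : ∀ m k (g : ℕ → ℤ) → k < m → Σℤ m (λ i → g i ℤ.* + ⟦ k ≡ᵇ i ⟧) ≡ g k
Σℤ-delta (suc m) zero g _ =
  trans (cong (ℤ._+_ (g 0 ℤ.* + 1)) (Σℤ-0 m (λ i → ℤ.*-zeroʳ (g (suc i)))))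
        (trans (ℤ.+-identityʳ _) (ℤ.*-identityʳ (g 0)))
Σℤ-delta (suc m) (suc k) g (s≤s k<m) =
  trans (cong (ℤ._+ Σℤ m (λ i → g (suc i) ℤ.* + ⟦ k ≡ᵇ i ⟧)) (ℤ.*-zeroʳ (g 0)))
        (trans (ℤ.+-identityˡ _) (Σℤ-delta m k (g ∘ suc) k<m))

sumFromTo≡Σℤ : ∀ a b f → sumFromTo a b f ≡ Σℤ (suc b ∸ a) (λ i → f (a + i))
sumFromTo≡Σℤ a b f = foldr-applyUpTo (λ i → f (a + i)) (λ i → i) (suc b ∸ a)
  where
  foldr-applyUpTo : (h : ℕ → ℤ) (g : ℕ → ℕ) (m : ℕ) →
    foldr (λ i acc → h i ℤ.+ acc) (+ 0) (applyUpTo g m) ≡ Σℤ m (h ∘ g)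
  foldr-applyUpTo h g zero = refl
  foldr-applyUpTo h g (suc m) = cong (ℤ._+_ (h (g 0))) (foldr-applyUpTo h (g ∘ suc) m)

-- The value o = 0 lies outside the range 1 ≤ μ ≤ r; there the hypothesis c 0 0 = 0 takes over.
Σℤ²-pointMass : ∀ r o s (c : ℕ → ℕ → ℤ) → s ≤ o → o ≤ r → c 0 0 ≡ + 0 →
  Σℤ r (λ i → Σℤ (suc (suc i)) (λ ν → c ν (suc i) ℤ.* + ⟦ (o ≡ᵇ suc i) ∧ (s ≡ᵇ ν) ⟧)) ≡ c s o
Σℤ²-pointMass r o s c s≤o o≤r c00 = trans (Σℤ-cong r inner) (outer o s≤o o≤r)
  where
  inner : (i : ℕ) → Σℤ (suc (suc i)) (λ ν → c ν (suc i) ℤ.* + ⟦ (o ≡ᵇ suc i) ∧ (s ≡ᵇ ν) ⟧)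
                  ≡ c s (suc i) ℤ.* + ⟦ o ≡ᵇ suc i ⟧
  inner i with o ≡ᵇ suc i in o≡1+i
  ... | true = trans (Σℤ-delta (suc (suc i)) s (λ ν → c ν (suc i))
                                (s≤s (subst (s ≤_) (≡ᵇ⇒≡ o (suc i) (subst T (sym o≡1+i) tt)) s≤o)))
                     (sym (ℤ.*-identityʳ (c s (suc i))))
  ... | false = trans (Σℤ-0 (suc (suc i)) (λ ν → ℤ.*-zeroʳ (c ν (suc i)))) (sym (ℤ.*-zeroʳ (c s (suc i))))
  outer : ∀ o → s ≤ o → o ≤ r → Σℤ r (λ i → c s (suc i) ℤ.* + ⟦ o ≡ᵇ suc i ⟧) ≡ c s o
  outer zero z≤n _ = trans (Σℤ-0 r (λ i → ℤ.*-zeroʳ (c 0 (suc i)))) (sym c00)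
  outer (suc k) _ k<r = Σℤ-delta r k (λ i → c s (suc i)) k<r

sumFromTo-regroup : {A : Set} (xs : List A) (o s : A → ℕ) (r : ℕ) (c : ℕ → ℕ → ℤ) →
  (∀ x → s x ≤ o x) → (∀ x → o x ≤ r) → c 0 0 ≡ + 0 →
  sumFromTo 1 r (λ μ → sumFromTo 0 μ (λ ν → c ν μ ℤ.* + countᵇ (λ x → (o x ≡ᵇ μ) ∧ (s x ≡ᵇ ν)) xs))
    ≡ ΣLℤ xs (λ x → c (s x) (o x))
sumFromTo-regroup {A} xs o s r c s≤o o≤r c00 = begin
  sumFromTo 1 r (λ μ → sumFromTo 0 μ (λ ν → c ν μ ℤ.* + countᵇ (pointMass μ ν) xs))
    ≡⟨ trans (sumFromTo≡Σℤ 1 r (λ μ → sumFromTo 0 μ (λ ν → c ν μ ℤ.* + countᵇ (pointMass μ ν) xs)))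
             (Σℤ-cong r (λ i → sumFromTo≡Σℤ 0 (suc i)
                                   (λ ν → c ν (suc i) ℤ.* + countᵇ (pointMass (suc i) ν) xs))) ⟩
  Σℤ r (λ i → Σℤ (suc (suc i)) (λ ν → c ν (suc i) ℤ.* + countᵇ (pointMass (suc i) ν) xs))
    ≡⟨ Σℤ-cong r (λ i → Σℤ-cong (suc (suc i)) (λ ν → count-as-sum i ν)) ⟩
  Σℤ r (λ i → Σℤ (suc (suc i)) (λ ν → ΣLℤ xs (term i ν)))
    ≡⟨ trans (Σℤ-cong r (λ i → Σℤ-ΣLℤ-swap (suc (suc i)) xs (term i)))
             (Σℤ-ΣLℤ-swap r xs (λ i x → Σℤ (suc (suc i)) (λ ν → term i ν x))) ⟩
  ΣLℤ xs (λ x → Σℤ r (λ i → Σℤ (suc (suc i)) (λ ν → term i ν x)))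
    ≡⟨ ΣLℤ-cong xs (λ x → Σℤ²-pointMass r (o x) (s x) c (s≤o x) (o≤r x) c00) ⟩
  ΣLℤ xs (λ x → c (s x) (o x)) ∎
  where
  open ≡-Reasoning
  pointMass : ℕ → ℕ → A → Bool
  pointMass μ ν x = (o x ≡ᵇ μ) ∧ (s x ≡ᵇ ν)
  term : ℕ → ℕ → A → ℤ
  term i ν x = c ν (suc i) ℤ.* + ⟦ pointMass (suc i) ν x ⟧
  count-as-sum : ∀ i ν → c ν (suc i) ℤ.* + countᵇ (pointMass (suc i) ν) xs ≡ ΣLℤ xs (term i ν)
  count-as-sum i ν =
    trans (cong (c ν (suc i) ℤ.*_) (trans (cong +_ (countᵇ≡ΣL (pointMass (suc i) ν) xs)) (ΣLℤ-ΣL xs _)))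
          (sym (ΣLℤ-*ˡ xs (c ν (suc i)) (λ x → + ⟦ pointMass (suc i) ν x ⟧)))

ΣO : (p n : ℕ) → (ℕ → ℕ → ℤ) → ℤ
ΣO p n c = sumFromTo 1 (n ⊓ p) (λ μ → sumFromTo 0 μ (λ ν → c ν μ ℤ.* + O p n ν μ))

sumFromTo-cong : ∀ a b {f g : ℕ → ℤ} → (∀ i → f i ≡ g i) → sumFromTo a b f ≡ sumFromTo a b g
sumFromTo-cong a b {f} {g} eq =
  trans (sumFromTo≡Σℤ a b f) (trans (Σℤ-cong (suc b ∸ a) (λ i → eq (a + i))) (sym (sumFromTo≡Σℤ a b g)))

ΣO-cong : (p n : ℕ) {c c′ : ℕ → ℕ → ℤ} → (∀ ν μ → c ν μ ≡ c′ ν μ) → ΣO p n c ≡ ΣO p n c′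
ΣO-cong p n eq =
  sumFromTo-cong 1 (n ⊓ p) (λ μ → sumFromTo-cong 0 μ (λ ν → cong (ℤ._* + O p n ν μ) (eq ν μ)))

ΣO≡ΣLℤ : (p n : ℕ) (c : ℕ → ℕ → ℤ) → c 0 0 ≡ + 0 →
  ΣO p n c ≡ ΣLℤ (allStates p n) (λ u → c (Census.ν u) (Census.μ u))
ΣO≡ΣLℤ p n c c00 =
  trans (sumFromTo-regroup (allStates p n) occupancy singletons (n ⊓ p) c s≤o o≤r c00)
        (ΣLℤ-cong (allStates p n) (λ u → cong₂ c (Census.singletons≡ν u) (Census.occupancy≡μ u)))
  where
  s≤o : (u : State p n) → singletons u ≤ occupancy u
  s≤o u = subst₂ _≤_ (sym (Census.singletons≡ν u)) (sym (Census.occupancy≡μ u)) (Census.ν≤μ u)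
  o≤r : (u : State p n) → occupancy u ≤ n ⊓ p
  o≤r u = subst (_≤ n ⊓ p) (sym (Census.occupancy≡μ u)) (⊓-glb (Census.μ≤n u) (Census.μ≤p u))

weight₂ weight₁₂ : ℕ → ℕ → ℕ → ℤ
weight₂ p ν μ = + 2 ℤ.* + p ℤ.* (+ ν - + μ) ℤ.+ + μ ℤ.* (+ 3 ℤ.* + μ - + 2 ℤ.* + ν - + 1)
weight₁₂ p ν μ = + 3 ℤ.* + μ ℤ.* + μ - + 2 ℤ.* + p ℤ.* + μ - + μ ℤ.+ + 4 ℤ.* + p ℤ.* + ν - + 4 ℤ.* + μ ℤ.* + ν

module Weights where

  census-weight₂ : ∀ P ν μ → μ ℤ.* μ - (+ 2 ℤ.* ((μ - ν) ℤ.* (P - μ)) ℤ.+ μ)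
                 ≡ + 2 ℤ.* P ℤ.* (ν - μ) ℤ.+ μ ℤ.* (+ 3 ℤ.* μ - + 2 ℤ.* ν - + 1)
  census-weight₂ = ℤ-Solver.solve-∀

  census-weight₁₂ : ∀ P ν μ → (μ ℤ.* μ ℤ.+ + 2 ℤ.* (ν ℤ.* (P - μ))) - (+ 2 ℤ.* ((μ - ν) ℤ.* (P - μ)) ℤ.+ μ)
                  ≡ + 3 ℤ.* μ ℤ.* μ - + 2 ℤ.* P ℤ.* μ - μ ℤ.+ + 4 ℤ.* P ℤ.* ν - + 4 ℤ.* μ ℤ.* ν
  census-weight₁₂ = ℤ-Solver.solve-∀

  weight₂-expand : ∀ P ν μ → + 2 ℤ.* P ℤ.* (ν - μ) ℤ.+ μ ℤ.* (+ 3 ℤ.* μ - + 2 ℤ.* ν - + 1)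
                 ≡ + 2 ℤ.* P ℤ.* ν - + 2 ℤ.* P ℤ.* μ ℤ.+ + 3 ℤ.* μ ℤ.* μ - + 2 ℤ.* μ ℤ.* ν - μ
  weight₂-expand = ℤ-Solver.solve-∀

  weight₁₂-factor : ∀ P ν μ → + 3 ℤ.* μ ℤ.* μ - + 2 ℤ.* P ℤ.* μ - μ ℤ.+ + 4 ℤ.* P ℤ.* ν - + 4 ℤ.* μ ℤ.* ν
                  ≡ + 4 ℤ.* ν ℤ.* (P - μ) ℤ.+ μ ℤ.* (+ 3 ℤ.* μ - + 2 ℤ.* P - + 1)
  weight₁₂-factor = ℤ-Solver.solve-∀

  weight₂-0-0 : ∀ P → + 2 ℤ.* P ℤ.* (+ 0 - + 0) ℤ.+ + 0 ℤ.* (+ 3 ℤ.* + 0 - + 2 ℤ.* + 0 - + 1) ≡ + 0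
  weight₂-0-0 = ℤ-Solver.solve-∀

  weight₁₂-0-0 : ∀ P → + 3 ℤ.* + 0 ℤ.* + 0 - + 2 ℤ.* P ℤ.* + 0 - + 0 ℤ.+ + 4 ℤ.* P ℤ.* + 0 - + 4 ℤ.* + 0 ℤ.* + 0 ≡ + 0
  weight₁₂-0-0 = ℤ-Solver.solve-∀


module _ (p n : ℕ) where
  open Census
  open Weights

  private
    S = allStates p n

    +E≡ : (u : State p n) → + E u ≡ + p - + μ u
    +E≡ u = pos-subtract (E u) (μ u) (E+μ≡p u)

    +[2ab] : ∀ a b → + (2 * (a * b)) ≡ + 2 ℤ.* (+ a ℤ.* + b)
    +[2ab] a b = trans (ℤ.pos-* 2 (a * b)) (cong (+ 2 ℤ.*_) (ℤ.pos-* a b))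

    +[2ME+μ] : (u : State p n) →
      + (2 * (M u * E u) + μ u) ≡ + 2 ℤ.* ((+ μ u - + ν u) ℤ.* (+ p - + μ u)) ℤ.+ + μ u
    +[2ME+μ] u = cong (ℤ._+ + μ u)
      (trans (+[2ab] (M u) (E u)) (cong (+ 2 ℤ.*_) (cong₂ ℤ._*_ (pos-subtract (M u) (ν u) (M+ν≡μ u)) (+E≡ u))))

    +[μμ+2νE] : (u : State p n) →
      + (μ u * μ u + 2 * (ν u * E u)) ≡ + μ u ℤ.* + μ u ℤ.+ + 2 ℤ.* (+ ν u ℤ.* (+ p - + μ u))
    +[μμ+2νE] u = trans (ℤ.pos-+ (μ u * μ u) _) (cong₂ ℤ._+_ (ℤ.pos-* (μ u) (μ u))
      (trans (+[2ab] (ν u) (E u)) (cong (λ x → + 2 ℤ.* (+ ν u ℤ.* x)) (+E≡ u))))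

  fourCardE₂≡ΣO : + (4 * cardE₂ p n) ≡ ΣO p n (weight₂ p)
  fourCardE₂≡ΣO = begin
    + (4 * cardE₂ p n)
      ≡⟨ ΣL-difference S _ _ _ (Counts.fourCardE₂≡ p n) ⟩
    ΣLℤ S (λ u → + (μ u * μ u) - + (2 * (M u * E u) + μ u))
      ≡⟨ ΣLℤ-cong S (λ u → trans (cong₂ _-_ (ℤ.pos-* (μ u) (μ u)) (+[2ME+μ] u))
                                 (census-weight₂ (+ p) (+ ν u) (+ μ u))) ⟩
    ΣLℤ S (λ u → weight₂ p (ν u) (μ u))
      ≡⟨ sym (ΣO≡ΣLℤ p n (weight₂ p) (weight₂-0-0 (+ p))) ⟩
    ΣO p n (weight₂ p) ∎
    where open ≡-Reasoning

  fourCardE₁₂≡ΣO : + (4 * (cardE₁ p n + cardE₂ p n)) ≡ ΣO p n (weight₁₂ p)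
  fourCardE₁₂≡ΣO = begin
    + (4 * (cardE₁ p n + cardE₂ p n))
      ≡⟨ ΣL-difference S _ _ _ (Counts.fourCardE₁₂≡ p n) ⟩
    ΣLℤ S (λ u → + (μ u * μ u + 2 * (ν u * E u)) - + (2 * (M u * E u) + μ u))
      ≡⟨ ΣLℤ-cong S (λ u → trans (cong₂ _-_ (+[μμ+2νE] u) (+[2ME+μ] u))
                                 (census-weight₁₂ (+ p) (+ ν u) (+ μ u))) ⟩
    ΣLℤ S (λ u → weight₁₂ p (ν u) (μ u))
      ≡⟨ sym (ΣO≡ΣLℤ p n (weight₁₂ p) (weight₁₂-0-0 (+ p))) ⟩
    ΣO p n (weight₁₂ p) ∎
    where open ≡-Reasoning

mainTheorem17 : (p n : ℕ) → 3 ≤ p →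
    let r = n ⊓ p
        P = + p
        T : (ℕ → ℕ → ℤ) → ℤ
        T c = sumFromTo 1 r (λ μ → sumFromTo 0 μ (λ ν → c ν μ ℤ.* + O p n ν μ))
    in ((+ (4 * cardE₂ p n)
          ≡ T (λ ν μ → + 2 ℤ.* P ℤ.* (+ ν - + μ) ℤ.+ + μ ℤ.* (+ 3 ℤ.* + μ - + 2 ℤ.* + ν - + 1)))
       × (T (λ ν μ → + 2 ℤ.* P ℤ.* (+ ν - + μ) ℤ.+ + μ ℤ.* (+ 3 ℤ.* + μ - + 2 ℤ.* + ν - + 1))
          ≡ T (λ ν μ → + 2 ℤ.* P ℤ.* + ν - + 2 ℤ.* P ℤ.* + μ ℤ.+ + 3 ℤ.* + μ ℤ.* + μ
                        - + 2 ℤ.* + μ ℤ.* + ν - + μ)))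
     × ((+ (4 * (cardE₁ p n + cardE₂ p n))
          ≡ T (λ ν μ → + 3 ℤ.* + μ ℤ.* + μ - + 2 ℤ.* P ℤ.* + μ - + μ
                        ℤ.+ + 4 ℤ.* P ℤ.* + ν - + 4 ℤ.* + μ ℤ.* + ν))
       × (T (λ ν μ → + 3 ℤ.* + μ ℤ.* + μ - + 2 ℤ.* P ℤ.* + μ - + μ
                      ℤ.+ + 4 ℤ.* P ℤ.* + ν - + 4 ℤ.* + μ ℤ.* + ν)
          ≡ T (λ ν μ → + 4 ℤ.* + ν ℤ.* (P - + μ) ℤ.+ + μ ℤ.* (+ 3 ℤ.* + μ - + 2 ℤ.* P - + 1))))
mainTheorem17 p n _ =
  ( fourCardE₂≡ΣO p n
  , ΣO-cong p n (λ ν μ → Weights.weight₂-expand (+ p) (+ ν) (+ μ)) )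
  , ( fourCardE₁₂≡ΣO p n
    , ΣO-cong p n (λ ν μ → Weights.weight₁₂-factor (+ p) (+ ν) (+ μ)) )
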